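{- For every integer $r\ge 1$ and every nonnegative integer $n$, $\overline{p}_r(n)=p_r^{\mathrm{mex}}(n)$.
   Context: A partition of $n$ is a finite non-increasing sequence of positive integers (parts) summing to $n$ (the empty partition for $n=0$). The mex of a partition $\lambda$ is the least positive integer that is not a part of $\lambda$. The mex sequence of $\lambda$ is the longest sequence of consecutive positive integers, starting with the mex of $\lambda$, none of which is a part of $\lambda$ (it may be infinite, e.g. for $(4,3,3,3,2,1,1)$ it is $5,6,7,\dots$; for $(9,4,4,3,1)$ it is $(2)$; for $(4)$ it is $(1,2,3)$). $p_r^{\mathrm{mex}}(n)$ is the number of partitions of $n$ whose mex sequence has length at least $r$. An overpartition of $n$ is a partition of $n$ in which the first occurrence of each part size may be overlined; equivalently a pair $(\lambda,\mu)$ with $\lambda$ a partition into distinct parts (the overlined parts), $\mu$ an ordinary partition (the non-overlined parts), $|\lambda|+|\mu|=n$. $\overline{p}_r(n)$ is the number of overpartitions of $n$ in which the overlined parts are unrestricted (besides being distinct) and every non-overlined part is greater than $r$ and has the same parity as $r+1$. -}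

module Defs where

open import Data.Nat using (ℕ; zero; suc; _+_; _∸_; _≤ᵇ_; _<ᵇ_; _≡ᵇ_)
open import Data.Nat.Properties using ()
open import Data.Bool using (Bool; true; false; _∧_; _∨_; not; if_then_else_)
open import Data.List using (List; []; _∷_; _++_; map; filter; length; concatMap; upTo; sum; cartesianProduct; allFin)
open import Data.Product using (_×_; _,_)
open import Relation.Nullary.Decidable using (Dec; yes; no)
open import Relation.Unary using (Pred; Decidable)
open import Data.Bool using (T)
open import Data.Bool.Properties using (T?)

-- A partition is represented as a list of its parts in non-increasing order.

-- partsFuel f n m : all partitions of n with every part ≤ m
-- (each exactly once, as non-increasing lists of positive integers),
-- provided the fuel f is ≥ n.
partsFuel : ℕ → ℕ → ℕ → List (List ℕ)
partsFuel _ zero _ = [] ∷ []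
partsFuel zero (suc _) _ = []
partsFuel (suc f) (suc n) zero = []
partsFuel (suc f) (suc n) (suc k) =
  partsFuel (suc f) (suc n) k ++
  (if suc k ≤ᵇ suc n then map (suc k ∷_) (partsFuel f (suc n ∸ suc k) (suc k)) else [])

partitions : ℕ → List (List ℕ)
partitions n = partsFuel n n n

elemᵇ : ℕ → List ℕ → Bool
elemᵇ k [] = false
elemᵇ k (x ∷ xs) = (k ≡ᵇ x) ∨ elemᵇ k xs

-- mex: least positive integer not a part.  Searching k = 1, 2, … ;
-- fuel (length + 1) suffices since a partition has finitely many parts.
mexFrom : ℕ → ℕ → List ℕ → ℕ
mexFrom zero k _ = k
mexFrom (suc f) k λ' = if elemᵇ k λ' then mexFrom f (suc k) λ' else k

mex : List ℕ → ℕ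
mex λ' = mexFrom (suc (length λ')) 1 λ'

-- the mex sequence of λ has length at least r:
-- none of mex λ, mex λ + 1, …, mex λ + r - 1 is a part of λ
mexSeqAtLeastᵇ : ℕ → List ℕ → Bool
mexSeqAtLeastᵇ r λ' = go r
  where
  go : ℕ → Bool
  go zero = true
  go (suc i) = not (elemᵇ (mex λ' + i) λ') ∧ go i

pmex : ℕ → ℕ → ℕ
pmex r n = length (filter (λ λ' → T? (mexSeqAtLeastᵇ r λ')) (partitions n))

-- distinct parts (parts listed non-increasingly, so: strictly decreasing)
distinctᵇ : List ℕ → Bool
distinctᵇ [] = true
distinctᵇ (x ∷ []) = true
distinctᵇ (x ∷ y ∷ xs) = (y <ᵇ x) ∧ distinctᵇ (y ∷ xs)

parityᵇ : ℕ → Bool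
parityᵇ zero = false
parityᵇ (suc n) = not (parityᵇ n)

allᵇ : (ℕ → Bool) → List ℕ → Bool
allᵇ P [] = true
allᵇ P (x ∷ xs) = P x ∧ allᵇ P xs

nonOverlinedOKᵇ : ℕ → List ℕ → Bool
nonOverlinedOKᵇ r μ = allᵇ (λ m → (r <ᵇ m) ∧ (parityᵇ m ≡ᵇB parityᵇ (suc r))) μ
  where
  _≡ᵇB_ : Bool → Bool → Bool
  true ≡ᵇB b = b
  false ≡ᵇB b = not b

-- overpartitions of n counted by p̄_r(n): pairs (λ, μ), λ a partition of k into
-- distinct parts (overlined parts), μ a partition of n ∸ k (non-overlined parts)
-- with every part > r and ≡ r + 1 (mod 2), for k = 0, …, n.
overpartitionsR : ℕ → ℕ → List (List ℕ × List ℕ)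
overpartitionsR r n = concatMap pairsAt (upTo (suc n))
  where
  pairsAt : ℕ → List (List ℕ × List ℕ)
  pairsAt k = cartesianProduct
    (filter (λ λ' → T? (distinctᵇ λ')) (partitions k))
    (filter (λ μ → T? (nonOverlinedOKᵇ r μ)) (partitions (n ∸ k)))

pbar : ℕ → ℕ → ℕ
pbar r n = length (overpartitionsR r n)

-- Both sides are compared through generating functions: a series is its coefficient function,
-- and a product over part sizes is a composite of operators applied to 1.  Sorting partitions
-- by their mex i + 1 gives p^mex_ℓ the generating function ∑ᵢ q^(i(i+1)/2) ∏_{j ∉ (i, i+ℓ]} 1/(1 - q^j),
-- while p̄_ℓ has ∏_j (1 + q^j) · ∏_{j > ℓ, j ≢ ℓ (mod 2)} 1/(1 - q^j).  Both satisfy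
-- F(ℓ) = F(ℓ + 2) + q^(ℓ+1) F(ℓ), which determines F(ℓ) from its coefficients of degree ≤ ℓ, and in
-- those degrees both reduce to ∏_j (1 + q^j) (for the mex side this is Euler's identity).  On the
-- mex side an auxiliary weight q^(i t) is inserted: splitting off the free part size just above or
-- just below the gap (i, i + ℓ] yields first-order recurrences in ℓ and in t, which combine to the
-- recurrence above and, by induction on t, give the boundary values.

module Submission where

open import Defs
open import Data.Nat using (ℕ; _≥_)
open import Relation.Binary.PropositionalEquality using (_≡_)

open import Data.Bool using (Bool; true; false; if_then_else_; _∧_; _∨_; not; _xor_; T)
open import Data.Bool.Properties using (not-involutive; ∧-zeroʳ; ⇔→≡)
open import Data.List using (List; []; _∷_; _++_; map; filter; length; applyUpTo; concatMap; cartesianProduct)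
open import Data.List.Properties using (filter-++; length-++; length-map)
open import Data.List.Relation.Unary.All using (All; []; _∷_)
import Data.List.Relation.Unary.All as All
open import Data.List.Relation.Unary.All.Properties using (++⁺; map⁺)
open import Data.Nat using (zero; suc; _+_; _*_; _∸_; _≤_; _<_; z≤n; s≤s; _≤ᵇ_; _<ᵇ_; _≡ᵇ_; _≤?_; _≟_)
open import Data.Nat.Induction using (<-rec)
open import Data.Nat.ListAction using (sum)
open import Data.Nat.Properties
open import Algebra.Properties.CommutativeSemigroup +-commutativeSemigroup
  using () renaming (interchange to +-interchange)
open import Data.Nat.Tactic.RingSolver using (solve-∀)
open import Data.Product using (_×_; _,_; proj₁; proj₂)
open import Data.Sum using (_⊎_; inj₁; inj₂)
open import Data.Unit using (⊤; tt)
open import Function using (_∘_; id)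
open import Function.Bundles using (mk⇔)
open import Relation.Binary.Definitions using (tri<; tri≈; tri>)
open import Relation.Binary.PropositionalEquality
  using (_≢_; _≗_; refl; sym; trans; cong; cong₂; subst; module ≡-Reasoning)
open import Relation.Nullary using (contradiction; yes; no)
open import Relation.Nullary.Decidable using (T?)

-- Formal power series

Series : Set
Series = ℕ → ℕ

infixl 6 _⊕_
_⊕_ : Series → Series → Series
(A ⊕ B) n = A n + B n

one : Series
one zero    = 1
one (suc _) = 0

shift : ℕ → Series → Series
shift zero    A n       = A n
shift (suc k) A zero    = 0
shift (suc k) A (suc n) = shift k A n

shift-< : ∀ k A {n} → n < k → shift k A n ≡ 0
shift-< (suc k) A {zero}  _         = refl
shift-< (suc k) A {suc n} (s≤s n<k) = shift-< k A n<k

shift-+ : ∀ k A n → shift k A (k + n) ≡ A n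
shift-+ zero    A n = refl
shift-+ (suc k) A n = shift-+ k A n

shift-if : ∀ k A n → shift k A n ≡ (if k ≤ᵇ n then A (n ∸ k) else 0)
shift-if zero          A n       = refl
shift-if (suc k)       A zero    = refl
shift-if (suc zero)    A (suc n) = refl
shift-if (suc (suc k)) A (suc n) = shift-if (suc k) A n

shift-cong≤ : ∀ k {A B} n → (∀ {m} → m ≤ n → A m ≡ B m) → shift k A n ≡ shift k B n
shift-cong≤ zero    n       eq = eq ≤-refl
shift-cong≤ (suc k) zero    eq = refl
shift-cong≤ (suc k) (suc n) eq = shift-cong≤ k n (λ m≤n → eq (m≤n⇒m≤1+n m≤n))

shift-cong< : ∀ k {A B} n → (∀ {m} → m < n → A m ≡ B m) → shift (suc k) A n ≡ shift (suc k) B n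
shift-cong< k zero    eq = refl
shift-cong< k (suc n) eq = shift-cong≤ k n (λ m≤n → eq (s≤s m≤n))

shift-cong : ∀ k {A B} → A ≗ B → shift k A ≗ shift k B
shift-cong k eq n = shift-cong≤ k n (λ {m} _ → eq m)

shift-⊕ : ∀ k A B → shift k (A ⊕ B) ≗ shift k A ⊕ shift k B
shift-⊕ zero    A B n       = refl
shift-⊕ (suc k) A B zero    = refl
shift-⊕ (suc k) A B (suc n) = shift-⊕ k A B n

shift-shift : ∀ a b A → shift a (shift b A) ≗ shift (a + b) A
shift-shift zero    b A n       = refl
shift-shift (suc a) b A zero    = refl
shift-shift (suc a) b A (suc n) = shift-shift a b A n

shift-comm : ∀ a b A → shift a (shift b A) ≗ shift b (shift a A)
shift-comm a b A n = begin
  shift a (shift b A) n ≡⟨ shift-shift a b A n ⟩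
  shift (a + b) A n     ≡⟨ cong (λ c → shift c A n) (+-comm a b) ⟩
  shift (b + a) A n     ≡⟨ shift-shift b a A n ⟨
  shift b (shift a A) n ∎
  where open ≡-Reasoning

shift-split : ∀ a b {c} A → c ≡ a + b → shift c A ≗ shift a (shift b A)
shift-split a b A eq n = trans (cong (λ e → shift e A n) eq) (sym (shift-shift a b A n))

shift-zero : ∀ k n → shift k (λ _ → 0) n ≡ 0
shift-zero zero    n       = refl
shift-zero (suc k) zero    = refl
shift-zero (suc k) (suc n) = shift-zero k n

-- geometric s A is A / (1 - q^(suc s)); the coefficient of q^n needs fuel n + 1.
geometricFuel : ℕ → ℕ → Series → Series
geometricFuel zero    s A   = A
geometricFuel (suc f) s A n = A n + shift (suc s) (geometricFuel f s A) n

geometric : ℕ → Series → Series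
geometric s A n = geometricFuel (suc n) s A n

geometricFuel-stable : ∀ s A {f g} n → n < f → n < g → geometricFuel f s A n ≡ geometricFuel g s A n
geometricFuel-stable s A {suc f} {suc g} n (s≤s n≤f) (s≤s n≤g) =
  cong (A n +_) (shift-cong< s n (λ {m} m<n →
    geometricFuel-stable s A m (<-≤-trans m<n n≤f) (<-≤-trans m<n n≤g)))

geometricFuel-cong≤ : ∀ f s {A B} n → (∀ {m} → m ≤ n → A m ≡ B m) →
                      geometricFuel f s A n ≡ geometricFuel f s B n
geometricFuel-cong≤ zero    s n eq = eq ≤-refl
geometricFuel-cong≤ (suc f) s n eq = cong₂ _+_ (eq ≤-refl) (shift-cong< s n (λ {m} m<n →
  geometricFuel-cong≤ f s m (λ k≤m → eq (≤-trans k≤m (<⇒≤ m<n)))))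

geometric-cong≤ : ∀ s {A B} n → (∀ {m} → m ≤ n → A m ≡ B m) → geometric s A n ≡ geometric s B n
geometric-cong≤ s n = geometricFuel-cong≤ (suc n) s n

geometric-cong : ∀ s {A B} → A ≗ B → geometric s A ≗ geometric s B
geometric-cong s eq n = geometric-cong≤ s n (λ {m} _ → eq m)

geometric-eq : ∀ s A → geometric s A ≗ A ⊕ shift (suc s) (geometric s A)
geometric-eq s A n = cong (A n +_) (shift-cong< s n (λ {m} m<n →
  geometricFuel-stable s A m m<n ≤-refl))

geometric-unique : ∀ s A B → B ≗ A ⊕ shift (suc s) B → B ≗ geometric s A
geometric-unique s A B eq = <-rec _ step
  where
  step : ∀ n → (∀ {m} → m < n → B m ≡ geometric s A m) → B n ≡ geometric s A n
  step n ih = begin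
    B n                                     ≡⟨ eq n ⟩
    A n + shift (suc s) B n                 ≡⟨ cong (A n +_) (shift-cong< s n ih) ⟩
    A n + shift (suc s) (geometric s A) n   ≡⟨ geometric-eq s A n ⟨
    geometric s A n                         ∎
    where open ≡-Reasoning

geometric-⊕ : ∀ s A B → geometric s (A ⊕ B) ≗ geometric s A ⊕ geometric s B
geometric-⊕ s A B n = sym (geometric-unique s (A ⊕ B) (geometric s A ⊕ geometric s B) eq n)
  where
  eq : geometric s A ⊕ geometric s B ≗ (A ⊕ B) ⊕ shift (suc s) (geometric s A ⊕ geometric s B)
  eq n = begin
    geometric s A n + geometric s B n
      ≡⟨ cong₂ _+_ (geometric-eq s A n) (geometric-eq s B n) ⟩
    (A n + shift (suc s) (geometric s A) n) + (B n + shift (suc s) (geometric s B) n)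
      ≡⟨ +-interchange (A n) _ (B n) _ ⟩
    (A n + B n) + (shift (suc s) (geometric s A) n + shift (suc s) (geometric s B) n)
      ≡⟨ cong (A n + B n +_) (shift-⊕ (suc s) (geometric s A) (geometric s B) n) ⟨
    (A n + B n) + shift (suc s) (geometric s A ⊕ geometric s B) n
      ∎
    where open ≡-Reasoning

geometric-shift : ∀ s k A → geometric s (shift k A) ≗ shift k (geometric s A)
geometric-shift s k A n = sym (geometric-unique s (shift k A) (shift k (geometric s A)) eq n)
  where
  eq : shift k (geometric s A) ≗ shift k A ⊕ shift (suc s) (shift k (geometric s A))
  eq n = begin
    shift k (geometric s A) n
      ≡⟨ shift-cong k (geometric-eq s A) n ⟩
    shift k (A ⊕ shift (suc s) (geometric s A)) n
      ≡⟨ shift-⊕ k A _ n ⟩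
    shift k A n + shift k (shift (suc s) (geometric s A)) n
      ≡⟨ cong (shift k A n +_) (shift-comm k (suc s) (geometric s A) n) ⟩
    shift k A n + shift (suc s) (shift k (geometric s A)) n
      ∎
    where open ≡-Reasoning

geometric-comm : ∀ s s′ A → geometric s (geometric s′ A) ≗ geometric s′ (geometric s A)
geometric-comm s s′ A = geometric-unique s′ (geometric s A) (geometric s (geometric s′ A)) eq
  where
  eq : geometric s (geometric s′ A) ≗ geometric s A ⊕ shift (suc s′) (geometric s (geometric s′ A))
  eq n = begin
    geometric s (geometric s′ A) n
      ≡⟨ geometric-cong s (geometric-eq s′ A) n ⟩
    geometric s (A ⊕ shift (suc s′) (geometric s′ A)) n
      ≡⟨ geometric-⊕ s A _ n ⟩
    geometric s A n + geometric s (shift (suc s′) (geometric s′ A)) n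
      ≡⟨ cong (geometric s A n +_) (geometric-shift s (suc s′) (geometric s′ A) n) ⟩
    geometric s A n + shift (suc s′) (geometric s (geometric s′ A)) n
      ∎
    where open ≡-Reasoning

∑< : ℕ → (ℕ → ℕ) → ℕ
∑< n f = sum (applyUpTo f n)

syntax ∑< n (λ i → e) = ∑[ i < n ] e

∑<-cong : ∀ n {f g} → (∀ {i} → i < n → f i ≡ g i) → ∑< n f ≡ ∑< n g
∑<-cong zero    eq = refl
∑<-cong (suc n) eq = cong₂ _+_ (eq (s≤s z≤n)) (∑<-cong n (λ i<n → eq (s≤s i<n)))

∑<-zero : ∀ n f → (∀ {i} → i < n → f i ≡ 0) → ∑< n f ≡ 0
∑<-zero zero    f z = refl
∑<-zero (suc n) f z = cong₂ _+_ (z (s≤s z≤n)) (∑<-zero n (f ∘ suc) (λ i<n → z (s≤s i<n)))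

∑<-+ : ∀ n f g → ∑[ i < n ] (f i + g i) ≡ ∑< n f + ∑< n g
∑<-+ zero    f g = refl
∑<-+ (suc n) f g =
  trans (cong (f 0 + g 0 +_) (∑<-+ n (f ∘ suc) (g ∘ suc))) (+-interchange (f 0) (g 0) _ _)

∑<-extend : ∀ n d f → (∀ {i} → n ≤ i → f i ≡ 0) → ∑< (n + d) f ≡ ∑< n f
∑<-extend zero    d f z = ∑<-zero d f (λ _ → z z≤n)
∑<-extend (suc n) d f z = cong (f 0 +_) (∑<-extend n d (f ∘ suc) (λ n≤i → z (s≤s n≤i)))

∑<-single : ∀ n f {i₀} → i₀ < n → (∀ {i} → i < n → i ≢ i₀ → f i ≡ 0) → ∑< n f ≡ f i₀
∑<-single (suc n) f {zero}   _          z =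
  trans (cong (f 0 +_) (∑<-zero n (f ∘ suc) (λ i<n → z (s≤s i<n) (λ ())))) (+-identityʳ (f 0))
∑<-single (suc n) f {suc i₀} (s≤s i₀<n) z =
  cong₂ _+_ (z (s≤s z≤n) (λ ())) (∑<-single n (f ∘ suc) i₀<n (λ i<n i≢ → z (s≤s i<n) (i≢ ∘ suc-injective)))

-- For a locally finite family only F 0, …, F n contribute in degree n, so ∑∞ is its sum.
LocallyFinite : (ℕ → Series) → Set
LocallyFinite F = ∀ {i n} → n < i → F i n ≡ 0

∑∞ : (ℕ → Series) → Series
∑∞ F n = ∑[ i < suc n ] F i n

∑∞-cong : ∀ {F G : ℕ → Series} → (∀ i → F i ≗ G i) → ∑∞ F ≗ ∑∞ G
∑∞-cong eq n = ∑<-cong (suc n) (λ {i} _ → eq i n)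

∑∞-⊕ : ∀ F G → ∑∞ (λ i → F i ⊕ G i) ≗ ∑∞ F ⊕ ∑∞ G
∑∞-⊕ F G n = ∑<-+ (suc n) (λ i → F i n) (λ i → G i n)

∑∞-peel : ∀ F → LocallyFinite F → ∑∞ F ≗ F 0 ⊕ ∑∞ (F ∘ suc)
∑∞-peel F lf n = cong (F 0 n +_) (sym (begin
  ∑[ i < suc n ] F (suc i) n  ≡⟨ cong (λ m → ∑[ i < m ] F (suc i) n) (+-comm 1 n) ⟩
  ∑[ i < n + 1 ] F (suc i) n  ≡⟨ ∑<-extend n 1 (λ i → F (suc i) n) (λ n≤i → lf (s≤s n≤i)) ⟩
  ∑[ i < n ] F (suc i) n      ∎))
  where open ≡-Reasoning

∑∞-shift : ∀ k F → LocallyFinite F → ∑∞ (λ i → shift k (F i)) ≗ shift k (∑∞ F)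
∑∞-shift k F lf n with k ≤? n
... | no n≱k  = trans (∑<-zero (suc n) _ (λ {i} _ → shift-< k (F i) (≰⇒> n≱k))) (sym (shift-< k _ (≰⇒> n≱k)))
... | yes k≤n = subst (λ n → ∑∞ (λ i → shift k (F i)) n ≡ shift k (∑∞ F) n) (m+[n∸m]≡n k≤n) (atOffset (n ∸ k))
  where
  open ≡-Reasoning
  atOffset : ∀ m → ∑∞ (λ i → shift k (F i)) (k + m) ≡ shift k (∑∞ F) (k + m)
  atOffset m = begin
    ∑[ i < suc (k + m) ] shift k (F i) (k + m) ≡⟨ ∑<-cong (suc (k + m)) (λ {i} _ → shift-+ k (F i) m) ⟩
    ∑[ i < suc (k + m) ] F i m                 ≡⟨ cong (λ c → ∑[ i < c ] F i m) (cong suc (+-comm k m)) ⟩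
    ∑[ i < suc m + k ] F i m                   ≡⟨ ∑<-extend (suc m) k (λ i → F i m) lf ⟩
    ∑∞ F m                                     ≡⟨ shift-+ k (∑∞ F) m ⟨
    shift k (∑∞ F) (k + m)                     ∎

infixl 7 _⊛_
_⊛_ : Series → Series → Series
(A ⊛ B) zero    = A 0 * B 0
(A ⊛ B) (suc n) = A 0 * B (suc n) + ((A ∘ suc) ⊛ B) n

⊛-∑ : ∀ A B n → (A ⊛ B) n ≡ ∑[ k < suc n ] (A k * B (n ∸ k))
⊛-∑ A B zero    = sym (+-identityʳ (A 0 * B 0))
⊛-∑ A B (suc n) = cong (A 0 * B (suc n) +_) (⊛-∑ (A ∘ suc) B n)

⊛-cong : ∀ A {B C} → B ≗ C → A ⊛ B ≗ A ⊛ C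
⊛-cong A eq zero    = cong (A 0 *_) (eq 0)
⊛-cong A eq (suc n) = cong₂ _+_ (cong (A 0 *_) (eq (suc n))) (⊛-cong (A ∘ suc) eq n)

⊛-⊕ : ∀ A B C → A ⊛ (B ⊕ C) ≗ A ⊛ B ⊕ A ⊛ C
⊛-⊕ A B C zero    = *-distribˡ-+ (A 0) (B 0) (C 0)
⊛-⊕ A B C (suc n) =
  trans (cong₂ _+_ (*-distribˡ-+ (A 0) (B (suc n)) (C (suc n))) (⊛-⊕ (A ∘ suc) B C n))
        (+-interchange (A 0 * B (suc n)) _ _ _)

⊛-shift₁ : ∀ A B → A ⊛ shift 1 B ≗ shift 1 (A ⊛ B)
⊛-shift₁ A B zero          = *-zeroʳ (A 0)
⊛-shift₁ A B (suc zero)    = trans (cong (A 0 * B 0 +_) (⊛-shift₁ (A ∘ suc) B zero)) (+-identityʳ _)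
⊛-shift₁ A B (suc (suc n)) = cong (A 0 * B (suc n) +_) (⊛-shift₁ (A ∘ suc) B (suc n))

⊛-shift : ∀ k A B → A ⊛ shift k B ≗ shift k (A ⊛ B)
⊛-shift zero    A B n = refl
⊛-shift (suc k) A B n = begin
  (A ⊛ shift (suc k) B) n        ≡⟨ ⊛-cong A (shift-shift 1 k B) n ⟨
  (A ⊛ shift 1 (shift k B)) n    ≡⟨ ⊛-shift₁ A (shift k B) n ⟩
  shift 1 (A ⊛ shift k B) n      ≡⟨ shift-cong 1 (⊛-shift k A B) n ⟩
  shift 1 (shift k (A ⊛ B)) n    ≡⟨ shift-shift 1 k (A ⊛ B) n ⟩
  shift (suc k) (A ⊛ B) n        ∎
  where open ≡-Reasoning

⊛-one : ∀ A B n → (∀ {j} → j ≤ n → B j ≡ one j) → (A ⊛ B) n ≡ A n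
⊛-one A B zero    eq = trans (cong (A 0 *_) (eq z≤n)) (*-identityʳ (A 0))
⊛-one A B (suc n) eq =
  cong₂ _+_ (trans (cong (A 0 *_) (eq ≤-refl)) (*-zeroʳ (A 0)))
            (⊛-one (A ∘ suc) B n (λ j≤n → eq (m≤n⇒m≤1+n j≤n)))

recurrence-unique : ∀ (A B : ℕ → Series) →
  (∀ ℓ → A ℓ ≗ A (suc (suc ℓ)) ⊕ shift (suc ℓ) (A ℓ)) →
  (∀ ℓ → B ℓ ≗ B (suc (suc ℓ)) ⊕ shift (suc ℓ) (B ℓ)) →
  (∀ ℓ {n} → n ≤ ℓ → A ℓ n ≡ B ℓ n) →
  ∀ ℓ → A ℓ ≗ B ℓ
recurrence-unique A B recA recB boundary ℓ n =
  <-rec (λ n → ∀ ℓ → A ℓ n ≡ B ℓ n) (λ n ih ℓ → descend n ih n ℓ (m≤n+m n ℓ)) n ℓ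
  where
  descend : ∀ n → (∀ {m} → m < n → ∀ ℓ → A ℓ m ≡ B ℓ m) → ∀ d ℓ → n ≤ ℓ + d → A ℓ n ≡ B ℓ n
  descend n ih zero    ℓ n≤ℓ = boundary ℓ (subst (n ≤_) (+-identityʳ ℓ) n≤ℓ)
  descend n ih (suc d) ℓ n≤  = begin
    A ℓ n                                   ≡⟨ recA ℓ n ⟩
    A (suc (suc ℓ)) n + shift (suc ℓ) (A ℓ) n
      ≡⟨ cong₂ _+_ (descend n ih d (suc (suc ℓ)) (≤-trans n≤ (≤-trans (≤-reflexive (+-suc ℓ d)) (n≤1+n _))))
                   (shift-cong< ℓ n (λ m<n → ih m<n ℓ)) ⟩
    B (suc (suc ℓ)) n + shift (suc ℓ) (B ℓ) n ≡⟨ recB ℓ n ⟨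
    B ℓ n                                   ∎
    where open ≡-Reasoning

<ᵇ-true : ∀ {m n} → m < n → (m <ᵇ n) ≡ true
<ᵇ-true {zero}  (s≤s _)   = refl
<ᵇ-true {suc m} (s≤s m<n) = <ᵇ-true m<n

<ᵇ-false : ∀ {m n} → n ≤ m → (m <ᵇ n) ≡ false
<ᵇ-false z≤n       = refl
<ᵇ-false (s≤s n≤m) = <ᵇ-false n≤m

<ᵇ-suc : ∀ {m n} → m ≢ n → (m <ᵇ suc n) ≡ (m <ᵇ n)
<ᵇ-suc {zero}  {zero}  m≢n = contradiction refl m≢n
<ᵇ-suc {zero}  {suc n} m≢n = refl
<ᵇ-suc {suc m} {zero}  m≢n = refl
<ᵇ-suc {suc m} {suc n} m≢n = <ᵇ-suc (m≢n ∘ cong suc)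

≡ᵇ-refl : ∀ n → (n ≡ᵇ n) ≡ true
≡ᵇ-refl zero    = refl
≡ᵇ-refl (suc n) = ≡ᵇ-refl n

≡ᵇ-false : ∀ {m n} → m ≢ n → (m ≡ᵇ n) ≡ false
≡ᵇ-false {zero}  {zero}  m≢n = contradiction refl m≢n
≡ᵇ-false {zero}  {suc n} _   = refl
≡ᵇ-false {suc m} {zero}  _   = refl
≡ᵇ-false {suc m} {suc n} m≢n = ≡ᵇ-false (m≢n ∘ cong suc)

∧-true : ∀ {a b} → a ∧ b ≡ true → a ≡ true × b ≡ true
∧-true {true} {true} _ = refl , refl

not-true : ∀ {b} → not b ≡ true → b ≡ false
not-true {false} _ = refl

∧-swap : ∀ a b c → a ∧ (b ∧ c) ≡ b ∧ (a ∧ c)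
∧-swap true  b     c = refl
∧-swap false true  c = refl
∧-swap false false c = refl

not-xor-self : ∀ b → not b xor b ≡ true
not-xor-self true  = refl
not-xor-self false = refl

not-not-xor-self : ∀ b → not (not b) xor b ≡ false
not-not-xor-self true  = refl
not-not-xor-self false = refl

-- Products over part sizes

data Mult : Set where
  absent free present atMostOnce : Mult

if-≢ : ∀ b {μ ν κ : Mult} → μ ≢ κ → ν ≢ κ → (if b then μ else ν) ≢ κ
if-≢ true  μ≢ ν≢ = μ≢
if-≢ false μ≢ ν≢ = ν≢

-- Multiplies A by the generating function of the part size suc k occurring with multiplicity μ.
factor : Mult → ℕ → Series → Series
factor absent     k A = A
factor free       k A = geometric k A
factor present    k A = shift (suc k) (geometric k A)
factor atMostOnce k A = A ⊕ shift (suc k) A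

factor-cong≤ : ∀ μ k {A B} n → (∀ {m} → m ≤ n → A m ≡ B m) → factor μ k A n ≡ factor μ k B n
factor-cong≤ absent     k n eq = eq ≤-refl
factor-cong≤ free       k n eq = geometric-cong≤ k n eq
factor-cong≤ present    k n eq =
  shift-cong≤ (suc k) n (λ {m} m≤n → geometric-cong≤ k m (λ i≤m → eq (≤-trans i≤m m≤n)))
factor-cong≤ atMostOnce k n eq = cong₂ _+_ (eq ≤-refl) (shift-cong≤ (suc k) n eq)

factor-cong : ∀ μ k {A B} → A ≗ B → factor μ k A ≗ factor μ k B
factor-cong μ k eq n = factor-cong≤ μ k n (λ {m} _ → eq m)

factor-⊕ : ∀ μ k A B → factor μ k (A ⊕ B) ≗ factor μ k A ⊕ factor μ k B
factor-⊕ absent     k A B n = refl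
factor-⊕ free       k A B   = geometric-⊕ k A B
factor-⊕ present    k A B n =
  trans (shift-cong (suc k) (geometric-⊕ k A B) n) (shift-⊕ (suc k) (geometric k A) (geometric k B) n)
factor-⊕ atMostOnce k A B n =
  trans (cong (A n + B n +_) (shift-⊕ (suc k) A B n)) (+-interchange (A n) (B n) _ _)

factor-shift : ∀ μ k j A → factor μ k (shift j A) ≗ shift j (factor μ k A)
factor-shift absent     k j A n = refl
factor-shift free       k j A   = geometric-shift k j A
factor-shift present    k j A n =
  trans (shift-cong (suc k) (geometric-shift k j A) n) (shift-comm (suc k) j (geometric k A) n)
factor-shift atMostOnce k j A n =
  trans (cong (shift j A n +_) (shift-comm (suc k) j A n)) (sym (shift-⊕ j A (shift (suc k) A) n))

factor-geometric : ∀ μ k s A → factor μ k (geometric s A) ≗ geometric s (factor μ k A)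
factor-geometric absent     k s A n = refl
factor-geometric free       k s A   = geometric-comm k s A
factor-geometric present    k s A n =
  trans (shift-cong (suc k) (geometric-comm k s A) n) (sym (geometric-shift s (suc k) (geometric k A) n))
factor-geometric atMostOnce k s A n =
  trans (cong (geometric s A n +_) (sym (geometric-shift s (suc k) A n))) (sym (geometric-⊕ s A (shift (suc k) A) n))

factor-comm : ∀ μ k ν j A → factor μ k (factor ν j A) ≗ factor ν j (factor μ k A)
factor-comm μ k absent     j A n = refl
factor-comm μ k free       j A   = factor-geometric μ k j A
factor-comm μ k present    j A n =
  trans (factor-shift μ k (suc j) (geometric j A) n) (shift-cong (suc j) (factor-geometric μ k j A) n)
factor-comm μ k atMostOnce j A n =
  trans (factor-⊕ μ k A (shift (suc j) A) n) (cong (factor μ k A n +_) (factor-shift μ k (suc j) A n))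

factor-stable : ∀ μ k A {n} → μ ≢ present → n ≤ k → factor μ k A n ≡ A n
factor-stable absent     k A μ≢ n≤k = refl
factor-stable free       k A μ≢ n≤k =
  trans (geometric-eq k A _) (trans (cong (A _ +_) (shift-< (suc k) _ (s≤s n≤k))) (+-identityʳ _))
factor-stable present    k A μ≢ n≤k = contradiction refl μ≢
factor-stable atMostOnce k A μ≢ n≤k = trans (cong (A _ +_) (shift-< (suc k) A (s≤s n≤k))) (+-identityʳ _)

-- τ j constrains the multiplicity of the part size j; τ 0 is never consulted.
Profile : Set
Profile = ℕ → Mult

prod : Profile → ℕ → Series
prod τ zero    = one
prod τ (suc k) = factor (τ (suc k)) k (prod τ k)

prod-ext : ∀ {τ τ′} K → (∀ {j} → j < K → τ (suc j) ≡ τ′ (suc j)) → prod τ K ≗ prod τ′ K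
prod-ext           zero    eq n = refl
prod-ext {τ} {τ′} (suc K) eq n =
  trans (cong (λ μ → factor μ K (prod τ K) n) (eq ≤-refl))
        (factor-cong (τ′ (suc K)) K (prod-ext K (λ j<K → eq (m<n⇒m<1+n j<K))) n)

triangle : ℕ → ℕ
triangle zero    = 0
triangle (suc i) = triangle i + suc i

≤-triangle : ∀ i → i ≤ triangle i
≤-triangle zero    = z≤n
≤-triangle (suc i) = m≤n+m (suc i) (triangle i)

prod-present : ∀ {τ τ′} K → (∀ {j} → j < K → τ (suc j) ≡ present × τ′ (suc j) ≡ free) →
               prod τ K ≗ shift (triangle K) (prod τ′ K)
prod-present zero _ n = refl
prod-present {τ} {τ′} (suc K) pf n = begin
  factor (τ (suc K)) K (prod τ K) n
    ≡⟨ cong (λ μ → factor μ K (prod τ K) n) (proj₁ (pf ≤-refl)) ⟩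
  shift (suc K) (geometric K (prod τ K)) n
    ≡⟨ shift-cong (suc K) (geometric-cong K (prod-present K (pf ∘ m<n⇒m<1+n))) n ⟩
  shift (suc K) (geometric K (shift (triangle K) (prod τ′ K))) n
    ≡⟨ shift-cong (suc K) (geometric-shift K (triangle K) (prod τ′ K)) n ⟩
  shift (suc K) (shift (triangle K) (geometric K (prod τ′ K))) n
    ≡⟨ shift-split (suc K) (triangle K) (geometric K (prod τ′ K)) (+-comm (triangle K) (suc K)) n ⟨
  shift (triangle (suc K)) (geometric K (prod τ′ K)) n
    ≡⟨ shift-cong (triangle (suc K)) (λ m → cong (λ μ → factor μ K (prod τ′ K) m) (proj₂ (pf ≤-refl))) n ⟨
  shift (triangle (suc K)) (prod τ′ (suc K)) n
    ∎
  where open ≡-Reasoning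

prod-agreeAbove : ∀ {τ τ′} c p → prod τ p ≗ shift c (prod τ′ p) → (∀ {j} → p ≤ j → τ (suc j) ≡ τ′ (suc j)) →
                  ∀ {K} → p ≤ K → prod τ K ≗ shift c (prod τ′ K)
prod-agreeAbove c p base eq {K} p≤K with m≤n⇒m<n∨m≡n p≤K
... | inj₂ refl = base
prod-agreeAbove {τ} {τ′} c p base eq {suc K} _ | inj₁ (s≤s p≤K) = λ n → begin
  factor (τ (suc K)) K (prod τ K) n
    ≡⟨ factor-cong (τ (suc K)) K (prod-agreeAbove c p base eq p≤K) n ⟩
  factor (τ (suc K)) K (shift c (prod τ′ K)) n
    ≡⟨ factor-shift (τ (suc K)) K c (prod τ′ K) n ⟩
  shift c (factor (τ (suc K)) K (prod τ′ K)) n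
    ≡⟨ shift-cong c (λ m → cong (λ μ → factor μ K (prod τ′ K) m) (eq p≤K)) n ⟩
  shift c (prod τ′ (suc K)) n
    ∎
  where open ≡-Reasoning

record Removes (k : ℕ) (τ τ′ : Profile) : Set where
  field
    removed : τ′ (suc k) ≡ absent
    agrees  : ∀ {j} → j ≢ k → τ (suc j) ≡ τ′ (suc j)

prod-pull : ∀ {k τ τ′} → Removes k τ τ′ → ∀ {K} → k < K → prod τ K ≗ factor (τ (suc k)) k (prod τ′ K)
prod-pull {k} {τ} {τ′} rm {suc K} (s≤s k≤K) with m≤n⇒m<n∨m≡n k≤K
... | inj₂ refl rewrite Removes.removed rm =
  factor-cong (τ (suc k)) k (prod-ext k (λ j<k → Removes.agrees rm (<⇒≢ j<k)))
... | inj₁ k<K = λ n → begin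
  factor (τ (suc K)) K (prod τ K) n
    ≡⟨ factor-cong (τ (suc K)) K (prod-pull rm k<K) n ⟩
  factor (τ (suc K)) K (factor (τ (suc k)) k (prod τ′ K)) n
    ≡⟨ factor-comm (τ (suc K)) K (τ (suc k)) k (prod τ′ K) n ⟩
  factor (τ (suc k)) k (factor (τ (suc K)) K (prod τ′ K)) n
    ≡⟨ cong (λ μ → factor (τ (suc k)) k (factor μ K (prod τ′ K)) n) (Removes.agrees rm (>⇒≢ k<K)) ⟩
  factor (τ (suc k)) k (prod τ′ (suc K)) n
    ∎
  where open ≡-Reasoning

NoPresent : Profile → Set
NoPresent τ = ∀ j → τ j ≢ present

product : Profile → Series
product τ n = prod τ n n

prod-stable : ∀ {τ} → NoPresent τ → ∀ {n K} → n ≤ K → prod τ K n ≡ product τ n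
prod-stable {τ} np {n} {K} n≤K with m≤n⇒m<n∨m≡n n≤K
... | inj₂ refl = refl
prod-stable {τ} np {n} {suc K} _ | inj₁ (s≤s n≤K) =
  trans (factor-stable (τ (suc K)) K (prod τ K) (np (suc K)) n≤K) (prod-stable np n≤K)

product-pull : ∀ {k τ τ′} → NoPresent τ → NoPresent τ′ → Removes k τ τ′ →
               product τ ≗ factor (τ (suc k)) k (product τ′)
product-pull {k} {τ} {τ′} npτ npτ′ rm n = begin
  product τ n                         ≡⟨ prod-stable npτ n≤K ⟨
  prod τ K n                          ≡⟨ prod-pull rm (s≤s (m≤m+n k n)) n ⟩
  factor (τ (suc k)) k (prod τ′ K) n  ≡⟨ factor-cong≤ (τ (suc k)) k n (λ m≤n → prod-stable npτ′ (≤-trans m≤n n≤K)) ⟩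
  factor (τ (suc k)) k (product τ′) n ∎
  where
  open ≡-Reasoning
  K = suc k + n
  n≤K : n ≤ K
  n≤K = m≤n+m n (suc k)

product-free : ∀ {k τ τ′} → NoPresent τ → NoPresent τ′ → Removes k τ τ′ → τ (suc k) ≡ free →
               product τ ≗ product τ′ ⊕ shift (suc k) (product τ)
product-free {k} {τ} {τ′} npτ npτ′ rm fr n = begin
  product τ n
    ≡⟨ pulled n ⟩
  geometric k (product τ′) n
    ≡⟨ geometric-eq k (product τ′) n ⟩
  product τ′ n + shift (suc k) (geometric k (product τ′)) n
    ≡⟨ cong (product τ′ n +_) (shift-cong (suc k) (sym ∘ pulled) n) ⟩
  product τ′ n + shift (suc k) (product τ) n
    ∎
  where
  open ≡-Reasoning
  pulled : product τ ≗ geometric k (product τ′)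
  pulled m = trans (product-pull npτ npτ′ rm m) (cong (λ μ → factor μ k (product τ′) m) fr)

product-atMostOnce : ∀ {k τ τ′} → NoPresent τ → NoPresent τ′ → Removes k τ τ′ → τ (suc k) ≡ atMostOnce →
                     product τ ≗ product τ′ ⊕ shift (suc k) (product τ′)
product-atMostOnce {k} {τ} {τ′} npτ npτ′ rm once n =
  trans (product-pull npτ npτ′ rm n) (cong (λ μ → factor μ k (product τ′) n) once)

product-trivial : ∀ τ n → (∀ {j} → j < n → τ (suc j) ≡ absent) → product τ n ≡ one n
product-trivial τ n eq = trans (prod-ext n eq n) (noFactors n)
  where
  noFactors : ∀ K → prod (λ _ → absent) K n ≡ one n
  noFactors zero    = refl
  noFactors (suc K) = noFactors K

-- Gaps, distinct parts and parity

gappedProfile : ℕ → ℕ → Profile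
gappedProfile i ℓ j = if (i <ᵇ j) ∧ (j ≤ᵇ i + ℓ) then absent else free

gapped : ℕ → ℕ → Series
gapped i ℓ = product (gappedProfile i ℓ)

gapped-noPresent : ∀ i ℓ → NoPresent (gappedProfile i ℓ)
gapped-noPresent i ℓ j = if-≢ ((i <ᵇ j) ∧ (j ≤ᵇ i + ℓ)) (λ ()) (λ ())

gapped-splitBelow : ∀ i ℓ → gapped (suc i) ℓ ≗ gapped i (suc ℓ) ⊕ shift (suc i) (gapped (suc i) ℓ)
gapped-splitBelow i ℓ = product-free (gapped-noPresent (suc i) ℓ) (gapped-noPresent i (suc ℓ)) removes free-at
  where
  absentIf : Bool → Mult
  absentIf b = if b then absent else free
  removes : Removes i (gappedProfile (suc i) ℓ) (gappedProfile i (suc ℓ))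
  removes = record
    { removed = cong absentIf (cong₂ _∧_ (<ᵇ-true (n<1+n i)) (<ᵇ-true (m<m+n i (s≤s z≤n))))
    ; agrees  = λ {j} j≢i → cong absentIf (cong₂ _∧_ (sym (<ᵇ-suc (j≢i ∘ sym))) (cong (j <ᵇ_) (sym (+-suc i ℓ))))
    }
  free-at : gappedProfile (suc i) ℓ (suc i) ≡ free
  free-at = cong (λ b → absentIf (b ∧ (i <ᵇ suc (i + ℓ)))) (<ᵇ-false (≤-refl {i}))

gapped-splitAbove : ∀ i ℓ → gapped i ℓ ≗ gapped i (suc ℓ) ⊕ shift (suc (i + ℓ)) (gapped i ℓ)
gapped-splitAbove i ℓ = product-free (gapped-noPresent i ℓ) (gapped-noPresent i (suc ℓ)) removes free-at
  where
  absentIf : Bool → Mult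
  absentIf b = if b then absent else free
  removes : Removes (i + ℓ) (gappedProfile i ℓ) (gappedProfile i (suc ℓ))
  removes = record
    { removed = cong absentIf (cong₂ _∧_ (<ᵇ-true (s≤s (m≤m+n i ℓ))) (<ᵇ-true (+-monoʳ-< i (n<1+n ℓ))))
    ; agrees  = λ {j} j≢ → cong (λ b → absentIf ((i <ᵇ suc j) ∧ b))
                                 (trans (sym (<ᵇ-suc j≢)) (cong (j <ᵇ_) (sym (+-suc i ℓ))))
    }
  free-at : gappedProfile i ℓ (suc (i + ℓ)) ≡ free
  free-at = cong absentIf (cong₂ _∧_ (<ᵇ-true (s≤s (m≤m+n i ℓ))) (<ᵇ-false (≤-refl {i + ℓ})))

gapped-trivial : ∀ ℓ {n} → n ≤ ℓ → gapped 0 ℓ n ≡ one n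
gapped-trivial ℓ {n} n≤ℓ = product-trivial (gappedProfile 0 ℓ) n
  (λ j<n → cong (λ b → if b then absent else free) (<ᵇ-true (<-≤-trans j<n n≤ℓ)))

distinctAboveProfile : ℕ → Profile
distinctAboveProfile t j = if t <ᵇ j then atMostOnce else absent

distinctAbove : ℕ → Series
distinctAbove t = product (distinctAboveProfile t)

distinctAbove-noPresent : ∀ t → NoPresent (distinctAboveProfile t)
distinctAbove-noPresent t j = if-≢ (t <ᵇ j) (λ ()) (λ ())

distinctAbove-split : ∀ t → distinctAbove t ≗ distinctAbove (suc t) ⊕ shift (suc t) (distinctAbove (suc t))
distinctAbove-split t =
  product-atMostOnce (distinctAbove-noPresent t) (distinctAbove-noPresent (suc t)) removes once-at
  where
  onceIf : Bool → Mult
  onceIf b = if b then atMostOnce else absent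
  removes : Removes t (distinctAboveProfile t) (distinctAboveProfile (suc t))
  removes = record
    { removed = cong onceIf (<ᵇ-false (≤-refl {t}))
    ; agrees  = λ j≢t → cong onceIf (<ᵇ-suc (j≢t ∘ sym))
    }
  once-at : distinctAboveProfile t (suc t) ≡ atMostOnce
  once-at = cong onceIf (<ᵇ-true (n<1+n t))

distinctAbove-trivial : ∀ t {n} → n ≤ t → distinctAbove t n ≡ one n
distinctAbove-trivial t {n} n≤t = product-trivial (distinctAboveProfile t) n
  (λ j<n → cong (λ b → if b then atMostOnce else absent) (<ᵇ-false (≤-trans j<n n≤t)))

oppositeParityAboveᵇ : ℕ → ℕ → Bool
oppositeParityAboveᵇ ℓ j = (ℓ <ᵇ j) ∧ (parityᵇ j xor parityᵇ ℓ)

oppositeParityProfile : ℕ → Profile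
oppositeParityProfile ℓ j = if oppositeParityAboveᵇ ℓ j then free else absent

oppositeParityAbove : ℕ → Series
oppositeParityAbove ℓ = product (oppositeParityProfile ℓ)

oppositeParity-noPresent : ∀ ℓ → NoPresent (oppositeParityProfile ℓ)
oppositeParity-noPresent ℓ j = if-≢ (oppositeParityAboveᵇ ℓ j) (λ ()) (λ ())

oppositeParityAboveᵇ-step : ∀ {ℓ j} → j ≢ ℓ →
  oppositeParityAboveᵇ ℓ (suc j) ≡ oppositeParityAboveᵇ (suc (suc ℓ)) (suc j)
oppositeParityAboveᵇ-step {ℓ} {j} j≢ℓ with <-cmp j (suc ℓ)
... | tri< j<1+ℓ _ _ =
  trans (cong (_∧ (not (parityᵇ j) xor parityᵇ ℓ)) (<ᵇ-false (≤∧≢⇒< (≤-pred j<1+ℓ) j≢ℓ)))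
        (sym (cong (_∧ (not (parityᵇ j) xor not (not (parityᵇ ℓ)))) (<ᵇ-false (<⇒≤ j<1+ℓ))))
... | tri≈ _ refl _ =
  trans (cong₂ _∧_ (<ᵇ-true (m<n⇒m<1+n (n<1+n ℓ))) (not-not-xor-self (parityᵇ ℓ)))
        (sym (cong (_∧ (not (not (parityᵇ ℓ)) xor not (not (parityᵇ ℓ)))) (<ᵇ-false (≤-refl {ℓ}))))
... | tri> _ _ 1+ℓ<j =
  cong₂ _∧_ (trans (<ᵇ-true (m<n⇒m<1+n (<-trans (n<1+n ℓ) 1+ℓ<j))) (sym (<ᵇ-true 1+ℓ<j)))
            (cong (not (parityᵇ j) xor_) (sym (not-involutive (parityᵇ ℓ))))

oppositeParityAbove-split : ∀ ℓ →
  oppositeParityAbove ℓ ≗ oppositeParityAbove (suc (suc ℓ)) ⊕ shift (suc ℓ) (oppositeParityAbove ℓ)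
oppositeParityAbove-split ℓ =
  product-free (oppositeParity-noPresent ℓ) (oppositeParity-noPresent (suc (suc ℓ))) removes free-at
  where
  freeIf : Bool → Mult
  freeIf b = if b then free else absent
  removes : Removes ℓ (oppositeParityProfile ℓ) (oppositeParityProfile (suc (suc ℓ)))
  removes = record
    { removed = cong (λ b → freeIf (b ∧ (not (parityᵇ ℓ) xor not (not (parityᵇ ℓ))))) (<ᵇ-false (n≤1+n ℓ))
    ; agrees  = λ j≢ℓ → cong freeIf (oppositeParityAboveᵇ-step j≢ℓ)
    }
  free-at : oppositeParityProfile ℓ (suc ℓ) ≡ free
  free-at = cong freeIf (cong₂ _∧_ (<ᵇ-true (n<1+n ℓ)) (not-xor-self (parityᵇ ℓ)))

oppositeParityAbove-trivial : ∀ ℓ {n} → n ≤ ℓ → oppositeParityAbove ℓ n ≡ one n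
oppositeParityAbove-trivial ℓ {n} n≤ℓ = product-trivial (oppositeParityProfile ℓ) n
  (λ {j} j<n → cong (λ b → if b ∧ (not (parityᵇ j) xor parityᵇ ℓ) then free else absent)
                    (<ᵇ-false (≤-trans j<n n≤ℓ)))

-- The generating-function identity

-- mexSum 0 ℓ is the generating function of p^mex_ℓ (mex i + 1 and a mex sequence of length ≥ ℓ
-- mean 1, …, i are parts and i + 1, …, i + ℓ are not); t is the auxiliary weight q^(i t).
mexTerm : ℕ → ℕ → ℕ → Series
mexTerm t ℓ i = shift (triangle i + i * t) (gapped i ℓ)

mexSum : ℕ → ℕ → Series
mexSum t ℓ = ∑∞ (mexTerm t ℓ)

mexTerm-locallyFinite : ∀ t ℓ → LocallyFinite (mexTerm t ℓ)
mexTerm-locallyFinite t ℓ {i} n<i =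
  shift-< _ (gapped i ℓ) (<-≤-trans n<i (≤-trans (≤-triangle i) (m≤m+n (triangle i) (i * t))))

mexTerm-stepℓ : ∀ t ℓ i → mexTerm t ℓ i ≗ mexTerm t (suc ℓ) i ⊕ shift (suc ℓ) (mexTerm (suc t) ℓ i)
mexTerm-stepℓ t ℓ i n = begin
  shift e (gapped i ℓ) n
    ≡⟨ shift-cong e (gapped-splitAbove i ℓ) n ⟩
  shift e (gapped i (suc ℓ) ⊕ shift (suc (i + ℓ)) (gapped i ℓ)) n
    ≡⟨ shift-⊕ e _ _ n ⟩
  mexTerm t (suc ℓ) i n + shift e (shift (suc (i + ℓ)) (gapped i ℓ)) n
    ≡⟨ cong (mexTerm t (suc ℓ) i n +_)
            (trans (shift-shift e (suc (i + ℓ)) (gapped i ℓ) n)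
                   (shift-split (suc ℓ) (triangle i + i * suc t) (gapped i ℓ) (exponent (triangle i) i t ℓ) n)) ⟩
  mexTerm t (suc ℓ) i n + shift (suc ℓ) (mexTerm (suc t) ℓ i) n
    ∎
  where
  open ≡-Reasoning
  e = triangle i + i * t
  exponent : ∀ T i t ℓ → T + i * t + suc (i + ℓ) ≡ suc ℓ + (T + i * suc t)
  exponent = solve-∀

mexTerm-stept : ∀ t ℓ i →
  mexTerm t ℓ (suc i) ≗ shift (suc t) (mexTerm (suc t) (suc ℓ) i) ⊕ mexTerm (suc t) ℓ (suc i)
mexTerm-stept t ℓ i n = begin
  shift e (gapped (suc i) ℓ) n
    ≡⟨ shift-cong e (gapped-splitBelow i ℓ) n ⟩
  shift e (gapped i (suc ℓ) ⊕ shift (suc i) (gapped (suc i) ℓ)) n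
    ≡⟨ shift-⊕ e _ _ n ⟩
  shift e (gapped i (suc ℓ)) n + shift e (shift (suc i) (gapped (suc i) ℓ)) n
    ≡⟨ cong₂ _+_ (shift-split (suc t) (triangle i + i * suc t) (gapped i (suc ℓ)) (exponent₁ (triangle i) i t) n)
                 (trans (shift-shift e (suc i) (gapped (suc i) ℓ) n)
                        (cong (λ c → shift c (gapped (suc i) ℓ) n) (exponent₂ (triangle i) i t))) ⟩
  shift (suc t) (mexTerm (suc t) (suc ℓ) i) n + mexTerm (suc t) ℓ (suc i) n
    ∎
  where
  open ≡-Reasoning
  e = triangle i + suc i + suc i * t
  exponent₁ : ∀ T i t → T + suc i + suc i * t ≡ suc t + (T + i * suc t)
  exponent₁ = solve-∀
  exponent₂ : ∀ T i t → T + suc i + suc i * t + suc i ≡ T + suc i + suc i * suc t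
  exponent₂ = solve-∀

mexSum-stepℓ : ∀ t ℓ → mexSum t ℓ ≗ mexSum t (suc ℓ) ⊕ shift (suc ℓ) (mexSum (suc t) ℓ)
mexSum-stepℓ t ℓ n = begin
  mexSum t ℓ n
    ≡⟨ ∑∞-cong (mexTerm-stepℓ t ℓ) n ⟩
  ∑∞ (λ i → mexTerm t (suc ℓ) i ⊕ shift (suc ℓ) (mexTerm (suc t) ℓ i)) n
    ≡⟨ ∑∞-⊕ (mexTerm t (suc ℓ)) (λ i → shift (suc ℓ) (mexTerm (suc t) ℓ i)) n ⟩
  mexSum t (suc ℓ) n + ∑∞ (λ i → shift (suc ℓ) (mexTerm (suc t) ℓ i)) n
    ≡⟨ cong (mexSum t (suc ℓ) n +_) (∑∞-shift (suc ℓ) (mexTerm (suc t) ℓ) (mexTerm-locallyFinite (suc t) ℓ) n) ⟩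
  mexSum t (suc ℓ) n + shift (suc ℓ) (mexSum (suc t) ℓ) n
    ∎
  where open ≡-Reasoning

mexSum-stept : ∀ t ℓ → mexSum t ℓ ≗ mexSum (suc t) ℓ ⊕ shift (suc t) (mexSum (suc t) (suc ℓ))
mexSum-stept t ℓ n = begin
  mexSum t ℓ n
    ≡⟨ ∑∞-peel (mexTerm t ℓ) (mexTerm-locallyFinite t ℓ) n ⟩
  gapped 0 ℓ n + ∑∞ (mexTerm t ℓ ∘ suc) n
    ≡⟨ cong (gapped 0 ℓ n +_) (∑∞-cong (mexTerm-stept t ℓ) n) ⟩
  gapped 0 ℓ n + ∑∞ (λ i → shift (suc t) (mexTerm (suc t) (suc ℓ) i) ⊕ mexTerm (suc t) ℓ (suc i)) n
    ≡⟨ cong (gapped 0 ℓ n +_) (∑∞-⊕ (λ i → shift (suc t) (mexTerm (suc t) (suc ℓ) i)) (mexTerm (suc t) ℓ ∘ suc) n) ⟩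
  gapped 0 ℓ n + (∑∞ (λ i → shift (suc t) (mexTerm (suc t) (suc ℓ) i)) n + rest)
    ≡⟨ cong (λ x → gapped 0 ℓ n + (x + rest))
            (∑∞-shift (suc t) (mexTerm (suc t) (suc ℓ)) (mexTerm-locallyFinite (suc t) (suc ℓ)) n) ⟩
  gapped 0 ℓ n + (shift (suc t) (mexSum (suc t) (suc ℓ)) n + rest)
    ≡⟨ +-exchange (gapped 0 ℓ n) _ rest ⟩
  (gapped 0 ℓ n + rest) + shift (suc t) (mexSum (suc t) (suc ℓ)) n
    ≡⟨ cong (_+ shift (suc t) (mexSum (suc t) (suc ℓ)) n)
            (∑∞-peel (mexTerm (suc t) ℓ) (mexTerm-locallyFinite (suc t) ℓ) n) ⟨
  mexSum (suc t) ℓ n + shift (suc t) (mexSum (suc t) (suc ℓ)) n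
    ∎
  where
  open ≡-Reasoning
  rest = ∑∞ (mexTerm (suc t) ℓ ∘ suc) n
  +-exchange : ∀ a b c → a + (b + c) ≡ (a + c) + b
  +-exchange = solve-∀

mexSum-rec : ∀ ℓ → mexSum 0 ℓ ≗ mexSum 0 (suc (suc ℓ)) ⊕ shift (suc ℓ) (mexSum 0 ℓ)
mexSum-rec ℓ n = begin
  mexSum 0 ℓ n
    ≡⟨ mexSum-stepℓ 0 ℓ n ⟩
  mexSum 0 (suc ℓ) n + shift (suc ℓ) (mexSum 1 ℓ) n
    ≡⟨ cong (_+ shift (suc ℓ) (mexSum 1 ℓ) n) (mexSum-stepℓ 0 (suc ℓ) n) ⟩
  mexSum 0 (suc (suc ℓ)) n + shift (suc (suc ℓ)) (mexSum 1 (suc ℓ)) n + shift (suc ℓ) (mexSum 1 ℓ) n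
    ≡⟨ cong (λ x → mexSum 0 (suc (suc ℓ)) n + x + shift (suc ℓ) (mexSum 1 ℓ) n)
            (shift-split (suc ℓ) 1 (mexSum 1 (suc ℓ)) (+-comm 1 (suc ℓ)) n) ⟩
  mexSum 0 (suc (suc ℓ)) n + shift (suc ℓ) (shift 1 (mexSum 1 (suc ℓ))) n + shift (suc ℓ) (mexSum 1 ℓ) n
    ≡⟨ +-exchange (mexSum 0 (suc (suc ℓ)) n) _ _ ⟩
  mexSum 0 (suc (suc ℓ)) n + (shift (suc ℓ) (mexSum 1 ℓ) n + shift (suc ℓ) (shift 1 (mexSum 1 (suc ℓ))) n)
    ≡⟨ cong (mexSum 0 (suc (suc ℓ)) n +_) (shift-⊕ (suc ℓ) (mexSum 1 ℓ) (shift 1 (mexSum 1 (suc ℓ))) n) ⟨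
  mexSum 0 (suc (suc ℓ)) n + shift (suc ℓ) (mexSum 1 ℓ ⊕ shift 1 (mexSum 1 (suc ℓ))) n
    ≡⟨ cong (mexSum 0 (suc (suc ℓ)) n +_) (shift-cong (suc ℓ) (mexSum-stept 0 ℓ) n) ⟨
  mexSum 0 (suc (suc ℓ)) n + shift (suc ℓ) (mexSum 0 ℓ) n
    ∎
  where
  open ≡-Reasoning
  +-exchange : ∀ a b c → a + b + c ≡ a + (c + b)
  +-exchange = solve-∀

mexSum-trivial : ∀ {t ℓ n} → n ≤ t → n ≤ ℓ → mexSum t ℓ n ≡ one n
mexSum-trivial {t} {ℓ} {n} n≤t n≤ℓ = begin
  mexSum t ℓ n                             ≡⟨ ∑∞-peel (mexTerm t ℓ) (mexTerm-locallyFinite t ℓ) n ⟩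
  gapped 0 ℓ n + ∑∞ (mexTerm t ℓ ∘ suc) n  ≡⟨ cong₂ _+_ (gapped-trivial ℓ n≤ℓ) (∑<-zero (suc n) _ vanish) ⟩
  one n + 0                                ≡⟨ +-identityʳ (one n) ⟩
  one n                                    ∎
  where
  open ≡-Reasoning
  vanish : ∀ {i} → i < suc n → mexTerm t ℓ (suc i) n ≡ 0
  vanish {i} _ = shift-< _ (gapped (suc i) ℓ)
    (≤-trans (s≤s n≤t) (+-mono-≤ (≤-trans (s≤s z≤n) (≤-triangle (suc i))) (m≤m+n t (i * t))))

mexSum-boundary : ∀ n t {ℓ} → n ≤ ℓ → mexSum t ℓ n ≡ distinctAbove t n
mexSum-boundary = <-rec _ (λ n ih t {ℓ} → descend n ih n t {ℓ} (m≤n+m n t))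
  where
  descend : ∀ n → (∀ {m} → m < n → ∀ t {ℓ} → m ≤ ℓ → mexSum t ℓ m ≡ distinctAbove t m) →
            ∀ d t {ℓ} → n ≤ t + d → n ≤ ℓ → mexSum t ℓ n ≡ distinctAbove t n
  descend n ih zero    t {ℓ} n≤t n≤ℓ =
    trans (mexSum-trivial (subst (n ≤_) (+-identityʳ t) n≤t) n≤ℓ)
          (sym (distinctAbove-trivial t (subst (n ≤_) (+-identityʳ t) n≤t)))
  descend n ih (suc d) t {ℓ} n≤ n≤ℓ = begin
    mexSum t ℓ n
      ≡⟨ mexSum-stept t ℓ n ⟩
    mexSum (suc t) ℓ n + shift (suc t) (mexSum (suc t) (suc ℓ)) n
      ≡⟨ cong₂ _+_ (descend n ih d (suc t) (≤-trans n≤ (≤-reflexive (+-suc t d))) n≤ℓ)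
                   (shift-cong< t n (λ m<n → ih m<n (suc t) (≤-trans (<⇒≤ m<n) (m≤n⇒m≤1+n n≤ℓ)))) ⟩
    distinctAbove (suc t) n + shift (suc t) (distinctAbove (suc t)) n
      ≡⟨ distinctAbove-split t n ⟨
    distinctAbove t n
      ∎
    where open ≡-Reasoning

overpartitionGF : ℕ → Series
overpartitionGF ℓ = distinctAbove 0 ⊛ oppositeParityAbove ℓ

overpartitionGF-rec : ∀ ℓ →
  overpartitionGF ℓ ≗ overpartitionGF (suc (suc ℓ)) ⊕ shift (suc ℓ) (overpartitionGF ℓ)
overpartitionGF-rec ℓ n = begin
  (D ⊛ oppositeParityAbove ℓ) n
    ≡⟨ ⊛-cong D (oppositeParityAbove-split ℓ) n ⟩
  (D ⊛ (oppositeParityAbove (suc (suc ℓ)) ⊕ shift (suc ℓ) (oppositeParityAbove ℓ))) n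
    ≡⟨ ⊛-⊕ D _ _ n ⟩
  overpartitionGF (suc (suc ℓ)) n + (D ⊛ shift (suc ℓ) (oppositeParityAbove ℓ)) n
    ≡⟨ cong (overpartitionGF (suc (suc ℓ)) n +_) (⊛-shift (suc ℓ) D (oppositeParityAbove ℓ) n) ⟩
  overpartitionGF (suc (suc ℓ)) n + shift (suc ℓ) (overpartitionGF ℓ) n
    ∎
  where
  open ≡-Reasoning
  D = distinctAbove 0

mexSum≗overpartitionGF : ∀ ℓ → mexSum 0 ℓ ≗ overpartitionGF ℓ
mexSum≗overpartitionGF = recurrence-unique (mexSum 0) overpartitionGF mexSum-rec overpartitionGF-rec
  (λ ℓ {n} n≤ℓ → trans (mexSum-boundary n 0 n≤ℓ)
    (sym (⊛-one (distinctAbove 0) (oppositeParityAbove ℓ) n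
      (λ j≤n → oppositeParityAbove-trivial ℓ (≤-trans j≤n n≤ℓ)))))

-- Counting partitions

indicator : Bool → ℕ
indicator true  = 1
indicator false = 0

count : (List ℕ → Bool) → List (List ℕ) → ℕ
count P xs = length (filter (λ x → T? (P x)) xs)

count-∷ : ∀ P x xs → count P (x ∷ xs) ≡ indicator (P x) + count P xs
count-∷ P x xs with P x
... | true  = refl
... | false = refl

count-++ : ∀ P xs ys → count P (xs ++ ys) ≡ count P xs + count P ys
count-++ P xs ys = trans (cong length (filter-++ (λ x → T? (P x)) xs ys)) (length-++ (filter (λ x → T? (P x)) xs))

count-map : ∀ P f xs → count P (map f xs) ≡ count (P ∘ f) xs
count-map P f []       = refl
count-map P f (x ∷ xs) =
  trans (count-∷ P (f x) (map f xs))
        (trans (cong (indicator (P (f x)) +_) (count-map P f xs)) (sym (count-∷ (P ∘ f) x xs)))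

count-if : ∀ P b xs → count P (if b then xs else []) ≡ (if b then count P xs else 0)
count-if P true  xs = refl
count-if P false xs = refl

count-cong : ∀ {P Q} xs → All (λ x → P x ≡ Q x) xs → count P xs ≡ count Q xs
count-cong {P} {Q} []       []         = refl
count-cong {P} {Q} (x ∷ xs) (eq ∷ eqs) =
  trans (count-∷ P x xs) (trans (cong₂ _+_ (cong indicator eq) (count-cong xs eqs)) (sym (count-∷ Q x xs)))

count-none : ∀ {P} xs → All (λ x → P x ≡ false) xs → count P xs ≡ 0
count-none {P} []       []         = refl
count-none {P} (x ∷ xs) (eq ∷ eqs) = trans (count-∷ P x xs) (cong₂ _+_ (cong indicator eq) (count-none xs eqs))

count-∑ : ∀ P (Q : ℕ → List ℕ → Bool) m xs →
          All (λ x → indicator (P x) ≡ ∑[ i < m ] indicator (Q i x)) xs →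
          count P xs ≡ ∑[ i < m ] count (Q i) xs
count-∑ P Q m []       []         = sym (∑<-zero m _ (λ _ → refl))
count-∑ P Q m (x ∷ xs) (eq ∷ eqs) = begin
  count P (x ∷ xs)                                                         ≡⟨ count-∷ P x xs ⟩
  indicator (P x) + count P xs                                             ≡⟨ cong₂ _+_ eq (count-∑ P Q m xs eqs) ⟩
  ∑[ i < m ] indicator (Q i x) + ∑[ i < m ] count (Q i) xs                 ≡⟨ ∑<-+ m _ _ ⟨
  ∑[ i < m ] (indicator (Q i x) + count (Q i) xs)                          ≡⟨ ∑<-cong m (λ {i} _ → count-∷ (Q i) x xs) ⟨
  ∑[ i < m ] count (Q i) (x ∷ xs)                                          ∎
  where open ≡-Reasoning

Sorted≤ : ℕ → List ℕ → Set
Sorted≤ b []       = ⊤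
Sorted≤ b (x ∷ xs) = x ≤ b × Sorted≤ x xs

Sorted≤-weaken : ∀ {b c} xs → b ≤ c → Sorted≤ b xs → Sorted≤ c xs
Sorted≤-weaken []       b≤c _          = tt
Sorted≤-weaken (x ∷ xs) b≤c (x≤b , xs≤) = ≤-trans x≤b b≤c , xs≤

partsFuel-sorted : ∀ f n k → All (Sorted≤ k) (partsFuel f n k)
partsFuel-sorted f       zero    k       = tt ∷ []
partsFuel-sorted zero    (suc n) k       = []
partsFuel-sorted (suc f) (suc n) zero    = []
partsFuel-sorted (suc f) (suc n) (suc k) =
  ++⁺ (All.map (λ {xs} → Sorted≤-weaken xs (n≤1+n k)) (partsFuel-sorted (suc f) (suc n) k)) withLargest
  where
  withLargest : All (Sorted≤ (suc k))
    (if suc k ≤ᵇ suc n then map (suc k ∷_) (partsFuel f (n ∸ k) (suc k)) else [])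
  withLargest with suc k ≤ᵇ suc n
  ... | true  = map⁺ (All.map (≤-refl ,_) (partsFuel-sorted f (n ∸ k) (suc k)))
  ... | false = []

partsFuel-irrelevant : ∀ {f g} n k → n ≤ f → n ≤ g → partsFuel f n k ≡ partsFuel g n k
partsFuel-irrelevant {f}     {g}     zero    k       _         _         = refl
partsFuel-irrelevant {suc f} {suc g} (suc n) zero    _         _         = refl
partsFuel-irrelevant {suc f} {suc g} (suc n) (suc k) (s≤s n≤f) (s≤s n≤g) =
  cong₂ _++_ (partsFuel-irrelevant (suc n) k (s≤s n≤f) (s≤s n≤g))
    (cong (λ ps → if suc k ≤ᵇ suc n then map (suc k ∷_) ps else [])
          (partsFuel-irrelevant (n ∸ k) (suc k) (≤-trans (m∸n≤m n k) n≤f) (≤-trans (m∸n≤m n k) n≤g)))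

countParts : (List ℕ → Bool) → ℕ → Series
countParts P k n = count P (partsFuel n n k)

countParts-zero : ∀ P → P [] ≡ true → countParts P 0 ≗ one
countParts-zero P eq zero    = trans (count-∷ P [] []) (cong (λ b → indicator b + 0) eq)
countParts-zero P eq (suc n) = refl

countParts-step : ∀ P k → countParts P (suc k) ≗ countParts P k ⊕ shift (suc k) (countParts (P ∘ (suc k ∷_)) (suc k))
countParts-step P k zero    = sym (+-identityʳ (count P ([] ∷ [])))
countParts-step P k (suc n) = begin
  count P (partsFuel (suc n) (suc n) k ++ (if b then map (suc k ∷_) ps else []))
    ≡⟨ count-++ P (partsFuel (suc n) (suc n) k) _ ⟩
  countParts P k (suc n) + count P (if b then map (suc k ∷_) ps else [])
    ≡⟨ cong (countParts P k (suc n) +_) (count-if P b _) ⟩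
  countParts P k (suc n) + (if b then count P (map (suc k ∷_) ps) else 0)
    ≡⟨ cong (λ c → countParts P k (suc n) + (if b then c else 0)) withLargest ⟩
  countParts P k (suc n) + (if b then countParts P′ (suc k) (n ∸ k) else 0)
    ≡⟨ cong (countParts P k (suc n) +_) (shift-if (suc k) (countParts P′ (suc k)) (suc n)) ⟨
  countParts P k (suc n) + shift (suc k) (countParts P′ (suc k)) (suc n)
    ∎
  where
  open ≡-Reasoning
  b  = suc k ≤ᵇ suc n
  ps = partsFuel n (n ∸ k) (suc k)
  P′ = P ∘ (suc k ∷_)
  withLargest : count P (map (suc k ∷_) ps) ≡ countParts P′ (suc k) (n ∸ k)
  withLargest = trans (count-map P (suc k ∷_) ps)
                      (cong (count P′) (partsFuel-irrelevant (n ∸ k) (suc k) (m∸n≤m n k) ≤-refl))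

countParts-cong : ∀ {P Q} k → (∀ {ν} → Sorted≤ k ν → P ν ≡ Q ν) → countParts P k ≗ countParts Q k
countParts-cong k eq n = count-cong _ (All.map eq (partsFuel-sorted n n k))

countParts-none : ∀ {P} k → (∀ {ν} → Sorted≤ k ν → P ν ≡ false) → ∀ n → countParts P k n ≡ 0
countParts-none k none n = count-none _ (All.map none (partsFuel-sorted n n k))

countParts-absent : ∀ P k → (∀ ν → P (suc k ∷ ν) ≡ false) → countParts P (suc k) ≗ countParts P k
countParts-absent P k none n = begin
  countParts P (suc k) n
    ≡⟨ countParts-step P k n ⟩
  countParts P k n + shift (suc k) (countParts (P ∘ (suc k ∷_)) (suc k)) n
    ≡⟨ cong (countParts P k n +_) (trans (shift-cong (suc k) (countParts-none (suc k) (λ {ν} _ → none ν)) n)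
                                         (shift-zero (suc k) n)) ⟩
  countParts P k n + 0
    ≡⟨ +-identityʳ _ ⟩
  countParts P k n
    ∎
  where open ≡-Reasoning

countParts-free : ∀ P k → (∀ ν → P (suc k ∷ ν) ≡ P ν) → countParts P (suc k) ≗ geometric k (countParts P k)
countParts-free P k eq = geometric-unique k (countParts P k) (countParts P (suc k)) λ n →
  trans (countParts-step P k n)
        (cong (countParts P k n +_) (shift-cong (suc k) (countParts-cong (suc k) (λ {ν} _ → eq ν)) n))

distinct-∷ : ∀ k ν → Sorted≤ k ν → distinctᵇ (suc k ∷ ν) ≡ distinctᵇ ν
distinct-∷ k []       _         = refl
distinct-∷ k (y ∷ ys) (y≤k , _) = cong (_∧ distinctᵇ (y ∷ ys)) (<ᵇ-true (s≤s y≤k))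

countParts-distinct : ∀ k → countParts distinctᵇ k ≗ prod (distinctAboveProfile 0) k
countParts-distinct zero    = countParts-zero distinctᵇ refl
countParts-distinct (suc k) n =
  trans (countParts-step distinctᵇ k n)
        (cong₂ _+_ (countParts-distinct k n) (shift-cong (suc k) largestOnce n))
  where
  largestOnce : countParts (distinctᵇ ∘ (suc k ∷_)) (suc k) ≗ prod (distinctAboveProfile 0) k
  largestOnce m = begin
    countParts (distinctᵇ ∘ (suc k ∷_)) (suc k) m
      ≡⟨ countParts-absent _ k (λ ν → cong (_∧ distinctᵇ (suc k ∷ ν)) (<ᵇ-false (≤-refl {k}))) m ⟩
    countParts (distinctᵇ ∘ (suc k ∷_)) k m
      ≡⟨ countParts-cong k (λ {ν} → distinct-∷ k ν) m ⟩
    countParts distinctᵇ k m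
      ≡⟨ countParts-distinct k m ⟩
    prod (distinctAboveProfile 0) k m
      ∎
    where open ≡-Reasoning

nonOverlinedOK-∷ : ∀ r j μ → nonOverlinedOKᵇ r (j ∷ μ) ≡ oppositeParityAboveᵇ r j ∧ nonOverlinedOKᵇ r μ
nonOverlinedOK-∷ r j μ with parityᵇ j | parityᵇ r
... | true  | true  = refl
... | true  | false = refl
... | false | true  = refl
... | false | false = refl

countParts-oppositeParity : ∀ r k → countParts (nonOverlinedOKᵇ r) k ≗ prod (oppositeParityProfile r) k
countParts-oppositeParity r zero    = countParts-zero (nonOverlinedOKᵇ r) refl
countParts-oppositeParity r (suc k) = byPart (oppositeParityAboveᵇ r (suc k)) refl
  where
  P = nonOverlinedOKᵇ r
  headRule : ∀ {b} → oppositeParityAboveᵇ r (suc k) ≡ b → ∀ ν → P (suc k ∷ ν) ≡ b ∧ P ν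
  headRule eq ν = trans (nonOverlinedOK-∷ r (suc k) ν) (cong (_∧ P ν) eq)
  byPart : ∀ b → oppositeParityAboveᵇ r (suc k) ≡ b →
           countParts P (suc k) ≗ factor (if b then free else absent) k (prod (oppositeParityProfile r) k)
  byPart true  eq n =
    trans (countParts-free P k (headRule eq) n) (geometric-cong k (countParts-oppositeParity r k) n)
  byPart false eq n =
    trans (countParts-absent P k (headRule eq) n) (countParts-oppositeParity r k n)

length-concatMap-applyUpTo : ∀ {A : Set} (g : ℕ → List A) h m →
  length (concatMap g (applyUpTo h m)) ≡ ∑[ i < m ] length (g (h i))
length-concatMap-applyUpTo g h zero    = refl
length-concatMap-applyUpTo g h (suc m) =
  trans (length-++ (g (h 0))) (cong (length (g (h 0)) +_) (length-concatMap-applyUpTo g (h ∘ suc) m))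

length-cartesianProduct : ∀ {A B : Set} (xs : List A) (ys : List B) →
  length (cartesianProduct xs ys) ≡ length xs * length ys
length-cartesianProduct []       ys = refl
length-cartesianProduct (x ∷ xs) ys =
  trans (length-++ (map (x ,_) ys)) (cong₂ _+_ (length-map (x ,_) ys) (length-cartesianProduct xs ys))

pbar≡overpartitionGF : ∀ r n → pbar r n ≡ overpartitionGF r n
pbar≡overpartitionGF r n =
  trans (length-concatMap-applyUpTo pairsAt id (suc n))
  (trans (∑<-cong (suc n) (λ {k} _ →
           trans (length-cartesianProduct (overlined k) (nonOverlined (n ∸ k)))
                 (cong₂ _*_ (countParts-distinct k k) (countParts-oppositeParity r (n ∸ k) (n ∸ k)))))
         (sym (⊛-∑ (distinctAbove 0) (oppositeParityAbove r) n)))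
  where
  overlined nonOverlined : ℕ → List (List ℕ)
  overlined    k = filter (λ ν → T? (distinctᵇ ν)) (partitions k)
  nonOverlined k = filter (λ ν → T? (nonOverlinedOKᵇ r ν)) (partitions k)
  pairsAt : ℕ → List (List ℕ × List ℕ)
  pairsAt k = cartesianProduct (overlined k) (nonOverlined (n ∸ k))

-- atMostOnce constrains multiplicities, which membership cannot see; such profiles are excluded below.
allowsᵇ : Mult → Bool → Bool
allowsᵇ absent     b = not b
allowsᵇ free       _ = true
allowsᵇ present    b = b
allowsᵇ atMostOnce _ = true

respectsᵇ : Profile → ℕ → List ℕ → Bool
respectsᵇ τ zero    ν = true
respectsᵇ τ (suc B) ν = allowsᵇ (τ (suc B)) (elemᵇ (suc B) ν) ∧ respectsᵇ τ B ν

elem-sorted : ∀ {k j} ν → Sorted≤ k ν → k < j → elemᵇ j ν ≡ false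
elem-sorted []       _          _   = refl
elem-sorted (y ∷ ys) (y≤k , ys≤) k<j =
  cong₂ _∨_ (≡ᵇ-false (>⇒≢ (≤-<-trans y≤k k<j))) (elem-sorted ys ys≤ (≤-<-trans y≤k k<j))

freeAt : ℕ → Profile → Profile
freeAt x τ j = if j ≡ᵇ x then free else τ j

freeAt-self : ∀ x τ → freeAt x τ x ≡ free
freeAt-self x τ = cong (λ b → if b then free else τ x) (≡ᵇ-refl x)

freeAt-other : ∀ x τ {j} → j ≢ x → freeAt x τ j ≡ τ j
freeAt-other x τ {j} j≢x = cong (λ b → if b then free else τ j) (≡ᵇ-false j≢x)

freeAt-≢ : ∀ x τ {μ} j → free ≢ μ → (j ≢ x → τ j ≢ μ) → freeAt x τ j ≢ μ
freeAt-≢ x τ j free≢ τj≢ with j ≟ x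
... | yes refl = subst (_≢ _) (sym (freeAt-self x τ)) free≢
... | no  j≢x  = subst (_≢ _) (sym (freeAt-other x τ j≢x)) (τj≢ j≢x)

freeAt-free : ∀ x τ → τ x ≡ free → ∀ j → freeAt x τ j ≡ τ j
freeAt-free x τ fr j with j ≟ x
... | yes refl = trans (freeAt-self x τ) (sym fr)
... | no  j≢x  = freeAt-other x τ j≢x

respects-ext : ∀ {τ τ′} B ν → (∀ {j} → j < B → τ (suc j) ≡ τ′ (suc j)) → respectsᵇ τ B ν ≡ respectsᵇ τ′ B ν
respects-ext zero    ν eq = refl
respects-ext (suc B) ν eq = cong₂ (λ μ c → allowsᵇ μ (elemᵇ (suc B) ν) ∧ c) (eq ≤-refl)
                                  (respects-ext B ν (λ j<B → eq (m<n⇒m<1+n j<B)))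

respects-above : ∀ τ B {x} ν → B < x → respectsᵇ τ B (x ∷ ν) ≡ respectsᵇ τ B ν
respects-above τ zero    ν _   = refl
respects-above τ (suc B) ν B<x =
  cong₂ (λ b c → allowsᵇ (τ (suc B)) b ∧ c) (cong (_∨ elemᵇ (suc B) ν) (≡ᵇ-false (<⇒≢ B<x)))
        (respects-above τ B ν (<-trans (n<1+n B) B<x))

respects-∷ : ∀ τ B {x} ν → x < B →
             respectsᵇ τ B (suc x ∷ ν) ≡ allowsᵇ (τ (suc x)) true ∧ respectsᵇ (freeAt (suc x) τ) B ν
respects-∷ τ (suc B) {x} ν (s≤s x≤B) with m≤n⇒m<n∨m≡n x≤B
... | inj₂ refl = cong₂ _∧_ (cong (λ b → allowsᵇ (τ (suc x)) (b ∨ elemᵇ (suc x) ν)) (≡ᵇ-refl x)) (begin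
  respectsᵇ τ x (suc x ∷ ν)
    ≡⟨ respects-above τ x ν ≤-refl ⟩
  respectsᵇ τ x ν
    ≡⟨ respects-ext x ν (λ j<x → sym (freeAt-other (suc x) τ (<⇒≢ (s≤s j<x)))) ⟩
  respectsᵇ τ′ x ν
    ≡⟨ cong (λ μ → allowsᵇ μ (elemᵇ (suc x) ν) ∧ respectsᵇ τ′ x ν) (freeAt-self (suc x) τ) ⟨
  allowsᵇ (τ′ (suc x)) (elemᵇ (suc x) ν) ∧ respectsᵇ τ′ x ν
    ∎)
  where
  open ≡-Reasoning
  τ′ = freeAt (suc x) τ
... | inj₁ x<B = begin
  allowsᵇ (τ (suc B)) ((suc B ≡ᵇ suc x) ∨ elemᵇ (suc B) ν) ∧ respectsᵇ τ B (suc x ∷ ν)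
    ≡⟨ cong₂ (λ b c → allowsᵇ (τ (suc B)) (b ∨ elemᵇ (suc B) ν) ∧ c) (≡ᵇ-false (>⇒≢ (s≤s x<B))) (respects-∷ τ B ν x<B) ⟩
  allowsᵇ (τ (suc B)) (elemᵇ (suc B) ν) ∧ (allowsᵇ (τ (suc x)) true ∧ respectsᵇ τ′ B ν)
    ≡⟨ ∧-swap (allowsᵇ (τ (suc B)) (elemᵇ (suc B) ν)) (allowsᵇ (τ (suc x)) true) (respectsᵇ τ′ B ν) ⟩
  allowsᵇ (τ (suc x)) true ∧ (allowsᵇ (τ (suc B)) (elemᵇ (suc B) ν) ∧ respectsᵇ τ′ B ν)
    ≡⟨ cong (λ μ → allowsᵇ (τ (suc x)) true ∧ (allowsᵇ μ (elemᵇ (suc B) ν) ∧ respectsᵇ τ′ B ν))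
            (freeAt-other (suc x) τ (>⇒≢ (s≤s x<B))) ⟨
  allowsᵇ (τ (suc x)) true ∧ (allowsᵇ (τ′ (suc B)) (elemᵇ (suc B) ν) ∧ respectsᵇ τ′ B ν)
    ∎
  where
  open ≡-Reasoning
  τ′ = freeAt (suc x) τ

respects-[] : ∀ τ B → (∀ {j} → j < B → τ (suc j) ≢ present) → respectsᵇ τ B [] ≡ true
respects-[] τ zero    np = refl
respects-[] τ (suc B) np =
  cong₂ _∧_ (allowsAbsence (τ (suc B)) (np ≤-refl)) (respects-[] τ B (λ j<B → np (m<n⇒m<1+n j<B)))
  where
  allowsAbsence : ∀ μ → μ ≢ present → allowsᵇ μ false ≡ true
  allowsAbsence absent     _   = refl
  allowsAbsence free       _   = refl
  allowsAbsence present    μ≢ = contradiction refl μ≢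
  allowsAbsence atMostOnce _   = refl

respects-false : ∀ τ B ν {j} → j < B → allowsᵇ (τ (suc j)) (elemᵇ (suc j) ν) ≡ false → respectsᵇ τ B ν ≡ false
respects-false τ (suc B) ν {j} (s≤s j≤B) violated with m≤n⇒m<n∨m≡n j≤B
... | inj₂ refl = cong (_∧ respectsᵇ τ j ν) violated
... | inj₁ j<B  =
  trans (cong (allowsᵇ (τ (suc B)) (elemᵇ (suc B) ν) ∧_) (respects-false τ B ν j<B violated)) (∧-zeroʳ _)

respects⇒allows : ∀ τ B ν → respectsᵇ τ B ν ≡ true → ∀ {j} → j < B → allowsᵇ (τ (suc j)) (elemᵇ (suc j) ν) ≡ true
respects⇒allows τ (suc B) ν ok {j} (s≤s j≤B) with ∧-true ok | m≤n⇒m<n∨m≡n j≤B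
... | okB , _   | inj₂ refl = okB
... | _   , ok′ | inj₁ j<B  = respects⇒allows τ B ν ok′ j<B

allows⇒respects : ∀ τ B ν → (∀ {j} → j < B → allowsᵇ (τ (suc j)) (elemᵇ (suc j) ν) ≡ true) → respectsᵇ τ B ν ≡ true
allows⇒respects τ zero    ν ok = refl
allows⇒respects τ (suc B) ν ok = cong₂ _∧_ (ok ≤-refl) (allows⇒respects τ B ν (λ j<B → ok (m<n⇒m<1+n j<B)))

countParts-respectsFree : ∀ {B} k τ → k < B → τ (suc k) ≡ free →
  countParts (respectsᵇ τ B) k ≗ prod τ k → countParts (respectsᵇ τ B) (suc k) ≗ geometric k (prod τ k)
countParts-respectsFree {B} k τ k<B fr ih n =
  trans (countParts-free (respectsᵇ τ B) k headFree n) (geometric-cong k ih n)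
  where
  open ≡-Reasoning
  headFree : ∀ ν → respectsᵇ τ B (suc k ∷ ν) ≡ respectsᵇ τ B ν
  headFree ν = begin
    respectsᵇ τ B (suc k ∷ ν)
      ≡⟨ respects-∷ τ B ν k<B ⟩
    allowsᵇ (τ (suc k)) true ∧ respectsᵇ (freeAt (suc k) τ) B ν
      ≡⟨ cong (λ μ → allowsᵇ μ true ∧ respectsᵇ (freeAt (suc k) τ) B ν) fr ⟩
    respectsᵇ (freeAt (suc k) τ) B ν
      ≡⟨ respects-ext B ν (λ {j} _ → freeAt-free (suc k) τ fr (suc j)) ⟩
    respectsᵇ τ B ν
      ∎

countParts-respectsPresent : ∀ {B} k τ → k < B → τ (suc k) ≡ present →
  countParts (respectsᵇ (freeAt (suc k) τ) B) k ≗ prod (freeAt (suc k) τ) k →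
  countParts (respectsᵇ τ B) (suc k) ≗ factor present k (prod τ k)
countParts-respectsPresent {B} k τ k<B pr ih n = begin
  countParts P (suc k) n
    ≡⟨ countParts-step P k n ⟩
  countParts P k n + shift (suc k) (countParts (P ∘ (suc k ∷_)) (suc k)) n
    ≡⟨ cong₂ _+_ (countParts-none k largestMissing n) (shift-cong (suc k) largestPresent n) ⟩
  shift (suc k) (geometric k (prod τ k)) n
    ∎
  where
  open ≡-Reasoning
  P  = respectsᵇ τ B
  τ′ = freeAt (suc k) τ
  largestMissing : ∀ {ν} → Sorted≤ k ν → P ν ≡ false
  largestMissing {ν} ν≤k =
    respects-false τ B ν k<B (trans (cong (λ μ → allowsᵇ μ (elemᵇ (suc k) ν)) pr) (elem-sorted ν ν≤k ≤-refl))
  largestPresent : countParts (P ∘ (suc k ∷_)) (suc k) ≗ geometric k (prod τ k)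
  largestPresent m = begin
    countParts (P ∘ (suc k ∷_)) (suc k) m
      ≡⟨ countParts-cong (suc k) (λ {ν} _ → trans (respects-∷ τ B ν k<B)
                                                  (cong (λ μ → allowsᵇ μ true ∧ respectsᵇ τ′ B ν) pr)) m ⟩
    countParts (respectsᵇ τ′ B) (suc k) m
      ≡⟨ countParts-respectsFree k τ′ k<B (freeAt-self (suc k) τ) ih m ⟩
    geometric k (prod τ′ k) m
      ≡⟨ geometric-cong k (prod-ext k (λ j<k → freeAt-other (suc k) τ (<⇒≢ (s≤s j<k)))) m ⟩
    geometric k (prod τ k) m
      ∎

countParts-respects : ∀ {B} k τ → k ≤ B → (∀ {j} → k < j → τ j ≢ present) → (∀ j → τ j ≢ atMostOnce) →
                      countParts (respectsᵇ τ B) k ≗ prod τ k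
countParts-respects {B} zero    τ _   np na = countParts-zero _ (respects-[] τ B (λ _ → np (s≤s z≤n)))
countParts-respects {B} (suc k) τ k<B np na = byPart (τ (suc k)) refl
  where
  ih : τ (suc k) ≢ present → countParts (respectsᵇ τ B) k ≗ prod τ k
  ih τk≢ = countParts-respects k τ (<⇒≤ k<B) npFrom na
    where
    npFrom : ∀ {j} → k < j → τ j ≢ present
    npFrom {j} k<j with m≤n⇒m<n∨m≡n k<j
    ... | inj₁ 1+k<j = np 1+k<j
    ... | inj₂ refl  = τk≢
  τ′ = freeAt (suc k) τ
  ih′ : countParts (respectsᵇ τ′ B) k ≗ prod τ′ k
  ih′ = countParts-respects k τ′ (<⇒≤ k<B)
    (λ {j} k<j → freeAt-≢ (suc k) τ j (λ ()) (λ j≢ → np (≤∧≢⇒< k<j (j≢ ∘ sym))))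
    (λ j → freeAt-≢ (suc k) τ j (λ ()) (λ _ → na j))
  byPart : ∀ μ → τ (suc k) ≡ μ → countParts (respectsᵇ τ B) (suc k) ≗ factor μ k (prod τ k)
  byPart absent     eq n = trans
    (countParts-absent (respectsᵇ τ B) k (λ ν → trans (respects-∷ τ B ν k<B)
                                                      (cong (λ μ → allowsᵇ μ true ∧ respectsᵇ τ′ B ν) eq)) n)
    (ih (subst (_≢ present) (sym eq) (λ ())) n)
  byPart free       eq = countParts-respectsFree k τ k<B eq (ih (subst (_≢ present) (sym eq) (λ ())))
  byPart present    eq = countParts-respectsPresent k τ k<B eq ih′
  byPart atMostOnce eq = contradiction eq (na (suc k))

-- The mex

mexFrom-≥ : ∀ f k ν → k ≤ mexFrom f k ν
mexFrom-≥ zero    k ν = ≤-refl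
mexFrom-≥ (suc f) k ν with elemᵇ k ν
... | true  = ≤-trans (n≤1+n k) (mexFrom-≥ f (suc k) ν)
... | false = ≤-refl

mexFrom-below : ∀ f k ν {j} → k ≤ j → j < mexFrom f k ν → elemᵇ j ν ≡ true
mexFrom-below zero    k ν     k≤j j<mex = contradiction j<mex (≤⇒≯ k≤j)
mexFrom-below (suc f) k ν {j} k≤j j<mex with elemᵇ k ν in found
... | false = contradiction j<mex (≤⇒≯ k≤j)
... | true with m≤n⇒m<n∨m≡n k≤j
...   | inj₂ refl = found
...   | inj₁ k<j  = mexFrom-below f (suc k) ν k<j j<mex

mexFrom-stops : ∀ f k ν → elemᵇ (mexFrom f k ν) ν ≡ false ⊎ mexFrom f k ν ≡ k + f
mexFrom-stops zero    k ν = inj₂ (sym (+-identityʳ k))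
mexFrom-stops (suc f) k ν with elemᵇ k ν in found
... | false = inj₁ found
... | true with mexFrom-stops f (suc k) ν
...   | inj₁ missing   = inj₁ missing
...   | inj₂ outOfFuel = inj₂ (trans outOfFuel (sym (+-suc k f)))

elem-bound : ∀ {b j} ν → Sorted≤ b ν → elemᵇ j ν ≡ true → j ≤ b
elem-bound {b} {j} (y ∷ ys) (y≤b , ys≤y) found with j ≡ᵇ y in j≡ᵇy
... | true  = ≤-trans (≤-reflexive (≡ᵇ⇒≡ j y (subst T (sym j≡ᵇy) tt))) y≤b
... | false = ≤-trans (elem-bound ys ys≤y found) y≤b

-- Pigeonhole; it shows that the fuel length ν + 1 in the definition of mex suffices.
sorted-length : ∀ {b} ν J → Sorted≤ b ν → (∀ {j} → j < J → elemᵇ (suc j) ν ≡ true) → J ≤ length ν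
sorted-length ν       zero    _         _   = z≤n
sorted-length []      (suc J) _         has with () ← has (≤-refl {suc J})
sorted-length (x ∷ ν) (suc J) (_ , ν≤x) has = s≤s (sorted-length ν J ν≤x hasInTail)
  where
  J<x : suc J ≤ x
  J<x = elem-bound (x ∷ ν) (≤-refl , ν≤x) (has ≤-refl)
  hasInTail : ∀ {j} → j < J → elemᵇ (suc j) ν ≡ true
  hasInTail {j} j<J = subst (λ b → b ∨ elemᵇ (suc j) ν ≡ true) (≡ᵇ-false (<⇒≢ (≤-trans (s≤s j<J) J<x)))
                            (has (m<n⇒m<1+n j<J))

mex-pos : ∀ ν → 1 ≤ mex ν
mex-pos ν = mexFrom-≥ (suc (length ν)) 1 ν

mex-below : ∀ ν {j} → suc j < mex ν → elemᵇ (suc j) ν ≡ true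
mex-below ν = mexFrom-below (suc (length ν)) 1 ν (s≤s z≤n)

mex-missing : ∀ {b} ν → Sorted≤ b ν → elemᵇ (mex ν) ν ≡ false
mex-missing ν ν≤b with mexFrom-stops (suc (length ν)) 1 ν
... | inj₁ missing   = missing
... | inj₂ outOfFuel = contradiction
  (sorted-length ν (suc (length ν)) ν≤b (λ {j} j< → mex-below ν (subst (suc j <_) (sym outOfFuel) (s≤s j<))))
  1+n≰n

mex-≤ : ∀ {b} ν → Sorted≤ b ν → mex ν ≤ suc b
mex-≤ {b} ν ν≤b with mex ν ≤? suc b
... | yes ok      = ok
... | no  tooLarge = contradiction (elem-bound ν ν≤b (mex-below ν (≰⇒> tooLarge))) 1+n≰n

mexSeq-elim : ∀ r ν → mexSeqAtLeastᵇ r ν ≡ true → ∀ {d} → d < r → elemᵇ (mex ν + d) ν ≡ false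
mexSeq-elim (suc r) ν ok {d} (s≤s d≤r) with ∧-true ok | m≤n⇒m<n∨m≡n d≤r
... | lastMissing , _ | inj₂ refl = not-true lastMissing
... | _ , restMissing | inj₁ d<r  = mexSeq-elim r ν restMissing d<r

mexSeq-intro : ∀ r ν → (∀ {d} → d < r → elemᵇ (mex ν + d) ν ≡ false) → mexSeqAtLeastᵇ r ν ≡ true
mexSeq-intro zero    ν missing = refl
mexSeq-intro (suc r) ν missing =
  cong₂ _∧_ (cong not (missing ≤-refl)) (mexSeq-intro r ν (λ d<r → missing (m<n⇒m<1+n d<r)))

mexProfile : ℕ → ℕ → Profile
mexProfile r i j = if j ≤ᵇ i then present else gappedProfile i r j

mexProfile-below : ∀ r {i j} → j < i → mexProfile r i (suc j) ≡ present
mexProfile-below r {i} {j} j<i = cong (λ b → if b then present else gappedProfile i r (suc j)) (<ᵇ-true j<i)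

mexProfile-window : ∀ r {i j} → i ≤ j → j < i + r → mexProfile r i (suc j) ≡ absent
mexProfile-window r {i} {j} i≤j j<i+r =
  trans (cong (λ b → if b then present else gappedProfile i r (suc j)) (<ᵇ-false i≤j))
        (cong₂ (λ b c → if b ∧ c then absent else free) (<ᵇ-true (s≤s i≤j)) (<ᵇ-true j<i+r))

mexProfile-above : ∀ r {i j} → i + r ≤ j → mexProfile r i (suc j) ≡ free
mexProfile-above r {i} {j} i+r≤j =
  trans (cong (λ b → if b then present else gappedProfile i r (suc j)) (<ᵇ-false i≤j))
        (cong₂ (λ b c → if b ∧ c then absent else free) (<ᵇ-true (s≤s i≤j)) (<ᵇ-false i+r≤j))
  where
  i≤j : i ≤ j
  i≤j = ≤-trans (m≤m+n i r) i+r≤j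

mexProfile-prod : ∀ r i {K} → i ≤ K → prod (mexProfile r i) K ≗ shift (triangle i) (prod (gappedProfile i r) K)
mexProfile-prod r i = prod-agreeAbove {mexProfile r i} {gappedProfile i r} (triangle i) i
  (prod-present {mexProfile r i} {gappedProfile i r} i presentBelow) agreeAbove
  where
  presentBelow : ∀ {j} → j < i → mexProfile r i (suc j) ≡ present × gappedProfile i r (suc j) ≡ free
  presentBelow {j} j<i =
    cong (λ b → if b then present else gappedProfile i r (suc j)) (<ᵇ-true j<i) ,
    cong (λ b → if b ∧ (j <ᵇ i + r) then absent else free) (<ᵇ-false j<i)
  agreeAbove : ∀ {j} → i ≤ j → mexProfile r i (suc j) ≡ gappedProfile i r (suc j)
  agreeAbove {j} i≤j = cong (λ b → if b then present else gappedProfile i r (suc j)) (<ᵇ-false i≤j)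

-- The bound i + r + n covers the window (i, i + r] and every part of a partition of n.
mexConditionᵇ : ℕ → ℕ → ℕ → List ℕ → Bool
mexConditionᵇ r n i = respectsᵇ (mexProfile r i) (i + r + n)

count-mexCondition : ∀ r n i → i ≤ n → count (mexConditionᵇ r n i) (partitions n) ≡ mexTerm 0 r i n
count-mexCondition r n i i≤n = begin
  countParts (respectsᵇ (mexProfile r i) (i + r + n)) n n
    ≡⟨ countParts-respects n (mexProfile r i) (m≤n+m n (i + r)) noPresent noAtMostOnce n ⟩
  prod (mexProfile r i) n n
    ≡⟨ mexProfile-prod r i i≤n n ⟩
  shift (triangle i) (prod (gappedProfile i r) n) n
    ≡⟨ shift-cong≤ (triangle i) n (λ m≤n → prod-stable (gapped-noPresent i r) m≤n) ⟩
  shift (triangle i) (gapped i r) n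
    ≡⟨ cong (λ c → shift c (gapped i r) n) (sym (trans (cong (triangle i +_) (*-zeroʳ i)) (+-identityʳ (triangle i)))) ⟩
  mexTerm 0 r i n
    ∎
  where
  open ≡-Reasoning
  noPresent : ∀ {j} → n < j → mexProfile r i j ≢ present
  noPresent {suc j} (s≤s n≤j) =
    subst (_≢ present)
          (sym (cong (λ b → if b then present else gappedProfile i r (suc j)) (<ᵇ-false (≤-trans i≤n n≤j))))
          (gapped-noPresent i r (suc j))
  noAtMostOnce : ∀ j → mexProfile r i j ≢ atMostOnce
  noAtMostOnce j = if-≢ (j ≤ᵇ i) (λ ()) (if-≢ ((i <ᵇ j) ∧ (j ≤ᵇ i + r)) (λ ()) (λ ()))

module _ {r n : ℕ} {ν : List ℕ} {i₀ : ℕ} (mex≡ : suc i₀ ≡ mex ν) where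

  mexCondition-off : r ≥ 1 → Sorted≤ n ν → ∀ {i} → i ≢ i₀ → mexConditionᵇ r n i ν ≡ false
  mexCondition-off r≥1 ν≤n {i} i≢i₀ with <-cmp i i₀
  ... | tri≈ _ i≡i₀ _ = contradiction i≡i₀ i≢i₀
  ... | tri< i<i₀ _ _ = respects-false (mexProfile r i) (i + r + n) ν
    (≤-trans (m<m+n i r≥1) (m≤m+n (i + r) n))
    (cong₂ allowsᵇ (mexProfile-window r ≤-refl (m<m+n i r≥1)) (mex-below ν (subst (suc i <_) mex≡ (s≤s i<i₀))))
  ... | tri> _ _ i₀<i = respects-false (mexProfile r i) (i + r + n) ν
    (<-≤-trans i₀<i (≤-trans (m≤m+n i r) (m≤m+n (i + r) n)))
    (cong₂ allowsᵇ (mexProfile-below r i₀<i) (trans (cong (λ m → elemᵇ m ν) mex≡) (mex-missing ν ν≤n)))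

  mexSeq-window : mexSeqAtLeastᵇ r ν ≡ true → ∀ {j} → i₀ ≤ j → j < i₀ + r → elemᵇ (suc j) ν ≡ false
  mexSeq-window ok {j} i₀≤j j<i₀+r = subst (λ m → elemᵇ m ν ≡ false) mex+d≡1+j (mexSeq-elim r ν ok d<r)
    where
    mex+d≡1+j : mex ν + (j ∸ i₀) ≡ suc j
    mex+d≡1+j = trans (cong (_+ (j ∸ i₀)) (sym mex≡)) (cong suc (m+[n∸m]≡n i₀≤j))
    d<r : j ∸ i₀ < r
    d<r = subst (j ∸ i₀ <_) (m+n∸m≡n i₀ r) (∸-monoˡ-< j<i₀+r i₀≤j)

  mexCondition-at : mexConditionᵇ r n i₀ ν ≡ mexSeqAtLeastᵇ r ν
  mexCondition-at = ⇔→≡ (mk⇔ toSeq fromSeq)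
    where
    B = i₀ + r + n
    allowedBy : ∀ {j μ} → mexProfile r i₀ (suc j) ≡ μ →
                allowsᵇ (mexProfile r i₀ (suc j)) (elemᵇ (suc j) ν) ≡ allowsᵇ μ (elemᵇ (suc j) ν)
    allowedBy {j} eq = cong (λ μ → allowsᵇ μ (elemᵇ (suc j) ν)) eq
    toSeq : mexConditionᵇ r n i₀ ν ≡ true → mexSeqAtLeastᵇ r ν ≡ true
    toSeq ok = mexSeq-intro r ν (λ {d} d<r → subst (λ m → elemᵇ (m + d) ν ≡ false) mex≡ (not-true (begin
      not (elemᵇ (suc (i₀ + d)) ν)
        ≡⟨ allowedBy (mexProfile-window r (m≤m+n i₀ d) (+-monoʳ-< i₀ d<r)) ⟨
      allowsᵇ (mexProfile r i₀ (suc (i₀ + d))) (elemᵇ (suc (i₀ + d)) ν)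
        ≡⟨ respects⇒allows (mexProfile r i₀) B ν ok (≤-trans (+-monoʳ-< i₀ d<r) (m≤m+n (i₀ + r) n)) ⟩
      true
        ∎)))
      where open ≡-Reasoning
    fromSeq : mexSeqAtLeastᵇ r ν ≡ true → mexConditionᵇ r n i₀ ν ≡ true
    fromSeq ok = allows⇒respects (mexProfile r i₀) B ν allowed
      where
      allowed : ∀ {j} → j < B → allowsᵇ (mexProfile r i₀ (suc j)) (elemᵇ (suc j) ν) ≡ true
      allowed {j} _ with j <? i₀ | j <? i₀ + r
      ... | yes j<i₀ | _           =
        trans (allowedBy (mexProfile-below r j<i₀)) (mex-below ν (subst (suc j <_) mex≡ (s≤s j<i₀)))
      ... | no  j≮i₀ | yes j<i₀+r =
        trans (allowedBy (mexProfile-window r (≮⇒≥ j≮i₀) j<i₀+r)) (cong not (mexSeq-window ok (≮⇒≥ j≮i₀) j<i₀+r))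
      ... | no  _    | no  j≮i₀+r = allowedBy (mexProfile-above r (≮⇒≥ j≮i₀+r))

indicator-mexSeq : ∀ {r n} → r ≥ 1 → ∀ {ν} → Sorted≤ n ν →
                   indicator (mexSeqAtLeastᵇ r ν) ≡ ∑[ i < suc n ] indicator (mexConditionᵇ r n i ν)
indicator-mexSeq {r} {n} r≥1 {ν} ν≤n = sym (begin
  ∑[ i < suc n ] indicator (mexConditionᵇ r n i ν)
    ≡⟨ ∑<-single (suc n) _ i₀<1+n (λ _ i≢i₀ → cong indicator (mexCondition-off mex≡ r≥1 ν≤n i≢i₀)) ⟩
  indicator (mexConditionᵇ r n i₀ ν)
    ≡⟨ cong indicator (mexCondition-at mex≡) ⟩
  indicator (mexSeqAtLeastᵇ r ν)
    ∎)
  where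
  open ≡-Reasoning
  i₀ = mex ν ∸ 1
  mex≡ : suc i₀ ≡ mex ν
  mex≡ = m+[n∸m]≡n (mex-pos ν)
  i₀<1+n : i₀ < suc n
  i₀<1+n = subst (_≤ suc n) (sym mex≡) (mex-≤ ν ν≤n)

pmex≡mexSum : ∀ r n → r ≥ 1 → pmex r n ≡ mexSum 0 r n
pmex≡mexSum r n r≥1 =
  trans (count-∑ (mexSeqAtLeastᵇ r) (mexConditionᵇ r n) (suc n) (partitions n)
                 (All.map (indicator-mexSeq r≥1) (partsFuel-sorted n n n)))
        (∑<-cong (suc n) (λ {i} i<1+n → count-mexCondition r n i (≤-pred i<1+n)))

theorem2p3 : (r n : ℕ) → r ≥ 1 → pbar r n ≡ pmex r n
theorem2p3 r n r≥1 = begin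
  pbar r n             ≡⟨ pbar≡overpartitionGF r n ⟩
  overpartitionGF r n  ≡⟨ mexSum≗overpartitionGF r n ⟨
  mexSum 0 r n         ≡⟨ pmex≡mexSum r n r≥1 ⟨
  pmex r n             ∎
  where open ≡-Reasoning
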